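{- Let $\Gamma=\mathbb{Z}^2\rtimes\mathcal{C}_s$ (the maps $x\mapsto\sigma x+(c,d)$, $c,d\in\mathbb{Z}$, $\sigma\in\{\mathrm{id},s\}$, $s(x,y)=(x,-y)$). Suppose $(G,m)$ is a $(\mathbb{Z}^2\rtimes\mathcal{C}_s)_q$-tight $\Gamma$-gain graph having a vertex $v_0$ of degree $3$ with edges $(v_0,v_1;g_1)$, $(v_0,v_2;g_2)$, $(v_0,v_3;g_3)$ to distinct vertices $v_1,v_2,v_3$ such that $\{v_0,v_1,v_2,v_3\}$ induces a balanced copy of $K_4$. Then a gained $K_4$-to-vertex move or a gained $4$-cycle-to-vertex move can be performed on $(G,m)$ to give a $(\mathbb{Z}^2\rtimes\mathcal{C}_s)_q$-tight $\Gamma$-gain graph with fewer vertices.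
   Context: A $\Gamma$-gain graph is a finite multigraph $G=(V,E)$ (loops, parallel edges allowed), edges oriented with gains in $\Gamma$, parallel edges of equal orientation having distinct gains and loops non-identity gains; $(v_i,v_j;g)$ is an edge from $v_i$ to $v_j$ with gain $g$. Net gain of a walk: product of gains along it (inverse for backward edges); gain space of a subgraph $H$ at $v$: subgroup generated by net gains of closed walks in $H$ at $v$; $H$ is balanced if all its gain spaces are trivial and purely periodic if they consist only of translations. A balanced copy of $K_4$: balanced subgraph whose underlying graph is the simple complete graph on 4 vertices. $(k,l)$-sparse: every subgraph with $|E'|\ge1$ has $|E'|\le k|V'|-l$; $(k,l)$-tight: also $|E|=k|V|-l$. $(G,m)$ is $(\mathbb{Z}^2\rtimes\mathcal{C}_s)_q$-tight if $G$ is $(2,1)$-tight and every purely periodic subgraph is $(2,2)$-sparse. Switching at $v$ by $\gamma$ replaces the gain $g$ of a loop at $v$ by $\gamma g\gamma^{ -1}$, of a non-loop edge directed out of $v$ by $\gamma g$, of a non-loop edge directed into $v$ by $g\gamma^{ -1}$; gain graphs related by sequences of switchings are equivalent. Gained vertex-to-$K_4$ move: replace a vertex $v_1$ by a copy of $K_4$ on $v_1$ and three new vertices, all its edges with identity gain; every other edge $(v_1,w;h)$ ($w$ possibly $v_1$) is unchanged or replaced by $(v_0,w;h)$ for another vertex $v_0$ of the copy. Gained vertex-to-4-cycle move: choose $v_1$ with edges $(v_1,v_2;g_{12}),(v_1,v_3;g_{13})$, $v_2\ne v_3$; add new $v_0$ with edges $(v_0,v_2;g_{02}),(v_0,v_3;g_{03})$,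 $g_{02}^{ -1}g_{03}=g_{12}^{ -1}g_{13}$; every other edge $(v_1,w;h)$ unchanged or replaced by $(v_0,w;h)$. A gain graph $(H,m_H)$ is obtained from $(G,m)$ by a gained $K_4$-to-vertex move (resp. $4$-cycle-to-vertex move) if a gain graph equivalent to $(G,m)$ is obtained from $(H,m_H)$ by a gained vertex-to-$K_4$ move (resp. vertex-to-$4$-cycle move). -}

module Defs where

open import Data.Bool using (Bool; true; false; if_then_else_; _xor_; _∧_)
open import Data.Nat using (ℕ; zero; suc; _+_; _*_; _≤_; _<_)
open import Data.Integer as ℤ using (ℤ; 0ℤ; -_) renaming (_+_ to _+ℤ_)
open import Data.Fin using (Fin; zero; suc; _↑ˡ_; _↑ʳ_; splitAt; _≟_)
open import Data.Fin.Subset using (Subset; _∈_; _⊆_; ∣_∣; ⊤; ⁅_⁆; _∪_)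
open import Data.Fin.Subset.Properties using (_∈?_)
open import Data.Vec using (tabulate)
open import Data.Maybe using (Maybe; just; nothing)
open import Data.Product using (Σ; ∃; _×_; _,_; proj₁; proj₂)
open import Data.Sum using (_⊎_; [_,_]′)
open import Relation.Nullary using (¬_; yes; no; does)
open import Relation.Binary.PropositionalEquality using (_≡_; _≢_)
open import Relation.Binary.Construct.Closure.ReflexiveTransitive using (Star)
open import Function.Bundles using (_↔_; Inverse)

-- The group Γ = ℤ² ⋊ C_s : maps x ↦ σ x + (c , d), σ ∈ {id , s},
-- s (x , y) = (x , - y).  σ = true means σ = s.

record Γ : Set where
  constructor ⟨_,_,_⟩
  field
    σ : Bool
    c : ℤ
    d : ℤ
open Γ public

-- composition (g · h) x = g (h x)
_·_ : Γ → Γ → Γ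
⟨ σ₁ , c₁ , d₁ ⟩ · ⟨ σ₂ , c₂ , d₂ ⟩ =
  ⟨ σ₁ xor σ₂ , c₁ +ℤ c₂ , d₁ +ℤ (if σ₁ then - d₂ else d₂) ⟩

ε : Γ
ε = ⟨ false , 0ℤ , 0ℤ ⟩

_⁻¹ : Γ → Γ
⟨ σ₁ , c₁ , d₁ ⟩ ⁻¹ = ⟨ σ₁ , - c₁ , (if σ₁ then d₁ else - d₁) ⟩

IsTranslation : Γ → Set
IsTranslation g = σ g ≡ false

record GainGraph : Set where
  field
    nV   : ℕ
    nE   : ℕ
    src  : Fin nE → Fin nV
    tgt  : Fin nE → Fin nV
    gain : Fin nE → Γ
open GainGraph public

IsGainGraph : GainGraph → Set
IsGainGraph G =
  (∀ e e' → e ≢ e' → src G e ≡ src G e' → tgt G e ≡ tgt G e' →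
     gain G e ≢ gain G e')
  × (∀ e → src G e ≡ tgt G e → gain G e ≢ ε)

IsSubgraph : (G : GainGraph) → Subset (nV G) → Subset (nE G) → Set
IsSubgraph G VS ES = ∀ e → e ∈ ES → (src G e ∈ VS) × (tgt G e ∈ VS)

data Walk (G : GainGraph) (ES : Subset (nE G)) : Fin (nV G) → Fin (nV G) → Set where
  []  : ∀ {u} → Walk G ES u u
  fwd : ∀ {w} e → e ∈ ES → Walk G ES (tgt G e) w → Walk G ES (src G e) w
  bwd : ∀ {w} e → e ∈ ES → Walk G ES (src G e) w → Walk G ES (tgt G e) w

netGain : ∀ {G ES u w} → Walk G ES u w → Γ
netGain []            = ε
netGain {G} (fwd e _ p) = gain G e · netGain p
netGain {G} (bwd e _ p) = (gain G e ⁻¹) · netGain p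

data GainSpace (G : GainGraph) (ES : Subset (nE G)) (v : Fin (nV G)) : Γ → Set where
  gen  : (p : Walk G ES v v) → GainSpace G ES v (netGain p)
  unit : GainSpace G ES v ε
  mul  : ∀ {g h} → GainSpace G ES v g → GainSpace G ES v h → GainSpace G ES v (g · h)
  inv  : ∀ {g} → GainSpace G ES v g → GainSpace G ES v (g ⁻¹)

IsBalanced : (G : GainGraph) → Subset (nV G) → Subset (nE G) → Set
IsBalanced G VS ES = ∀ v → v ∈ VS → ∀ g → GainSpace G ES v g → g ≡ ε

IsPurelyPeriodic : (G : GainGraph) → Subset (nV G) → Subset (nE G) → Set
IsPurelyPeriodic G VS ES = ∀ v → v ∈ VS → ∀ g → GainSpace G ES v g → IsTranslation g

SparseOn : ℕ → ℕ → (G : GainGraph) → Subset (nV G) → Subset (nE G) → Set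
SparseOn k l G VS ES =
  ∀ VS' ES' → IsSubgraph G VS' ES' → VS' ⊆ VS → ES' ⊆ ES →
  1 ≤ ∣ ES' ∣ → ∣ ES' ∣ + l ≤ k * ∣ VS' ∣

Sparse : ℕ → ℕ → GainGraph → Set
Sparse k l G = SparseOn k l G ⊤ ⊤

Tight : ℕ → ℕ → GainGraph → Set
Tight k l G = Sparse k l G × (nE G + l ≡ k * nV G)

QTight : GainGraph → Set
QTight G =
  Tight 2 1 G ×
  (∀ VS ES → IsSubgraph G VS ES → IsPurelyPeriodic G VS ES → SparseOn 2 2 G VS ES)

-- degree (a loop counts twice)

sumFin : ∀ {m} → (Fin m → ℕ) → ℕ
sumFin {zero}  f = 0
sumFin {suc m} f = f zero + sumFin (λ i → f (suc i))

ind : Bool → ℕ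
ind b = if b then 1 else 0

degree : (G : GainGraph) → Fin (nV G) → ℕ
degree G v = sumFin (λ e → ind (does (src G e ≟ v)) + ind (does (tgt G e ≟ v)))

Joins : (G : GainGraph) → Fin (nE G) → Fin (nV G) → Fin (nV G) → Set
Joins G e a b = (src G e ≡ a × tgt G e ≡ b) ⊎ (src G e ≡ b × tgt G e ≡ a)

fourSet : ∀ {n} → (Fin 4 → Fin n) → Subset n
fourSet v = ⁅ v zero ⁆ ∪ (⁅ v (suc zero) ⁆ ∪ (⁅ v (suc (suc zero)) ⁆ ∪ ⁅ v (suc (suc (suc zero))) ⁆))

inducedEdges : (G : GainGraph) → Subset (nV G) → Subset (nE G)
inducedEdges G VS = tabulate (λ e → does (src G e ∈? VS) ∧ does (tgt G e ∈? VS))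

InducesBalancedK4 : (G : GainGraph) → (Fin 4 → Fin (nV G)) → Set
InducesBalancedK4 G v =
  (∀ i j → v i ≡ v j → i ≡ j) ×
  IsBalanced G (fourSet v) (inducedEdges G (fourSet v)) ×
  (∀ e → e ∈ inducedEdges G (fourSet v) → src G e ≢ tgt G e) ×
  (∀ i j → i ≢ j →
     (∃ λ e → Joins G e (v i) (v j)) ×
     (∀ e e' → Joins G e (v i) (v j) → Joins G e' (v i) (v j) → e ≡ e'))

-- equivalence of gain graphs: switchings, together with relabelling of
-- vertices/edges and reversal of edges ((u,w;g) = (w,u;g⁻¹))

switchGain : ∀ {n} → Fin n → Γ → Fin n → Fin n → Γ → Γ
switchGain v γ a b g with a ≟ v | b ≟ v
... | yes _ | yes _ = (γ · g) · (γ ⁻¹)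
... | yes _ | no _  = γ · g
... | no _  | yes _ = g · (γ ⁻¹)
... | no _  | no _  = g

switch : (G : GainGraph) → Fin (nV G) → Γ → GainGraph
switch G v γ = record
  { nV = nV G ; nE = nE G ; src = src G ; tgt = tgt G
  ; gain = λ e → switchGain v γ (src G e) (tgt G e) (gain G e) }

Switching : GainGraph → GainGraph → Set
Switching G H = Σ (Fin (nV G)) λ v → Σ Γ λ γ → switch G v γ ≡ H

Iso : GainGraph → GainGraph → Set
Iso G H =
  Σ (Fin (nV G) ↔ Fin (nV H)) λ π → Σ (Fin (nE G) ↔ Fin (nE H)) λ τ →
  ∀ e → let p = Inverse.to π ; e' = Inverse.to τ e in
    (src H e' ≡ p (src G e) × tgt H e' ≡ p (tgt G e) × gain H e' ≡ gain G e)
    ⊎ (src H e' ≡ p (tgt G e) × tgt H e' ≡ p (src G e) × gain H e' ≡ gain G e ⁻¹)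

Step : GainGraph → GainGraph → Set
Step G H = Switching G H ⊎ Iso G H

Equivalent : GainGraph → GainGraph → Set
Equivalent = Star (λ G H → Step G H ⊎ Step H G)

-- adding k new vertices (indices nV ↑ʳ a) and j new edges, and
-- redirecting endpoints of old edges to new vertices.
-- ch e = just (true , a): the source endpoint of e is replaced by new a
-- ch e = just (false , a): the target endpoint of e is replaced by new a

extend : (G : GainGraph) (k j : ℕ) →
         (Fin j → Fin (nV G + k) × Fin (nV G + k) × Γ) →
         (Fin (nE G) → Maybe (Bool × Fin k)) → GainGraph
extend G k j newE ch = record
  { nV = nV G + k ; nE = nE G + j
  ; src = λ e → proj₁ (edge e)
  ; tgt = λ e → proj₁ (proj₂ (edge e))
  ; gain = λ e → proj₂ (proj₂ (edge e)) }
  where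
  old : Fin (nV G) → Fin (nV G + k)
  old v = v ↑ˡ k
  new : Fin k → Fin (nV G + k)
  new a = nV G ↑ʳ a
  oldEdge : Fin (nE G) → Fin (nV G + k) × Fin (nV G + k) × Γ
  oldEdge e with ch e
  ... | nothing          = old (src G e) , old (tgt G e) , gain G e
  ... | just (true , a)  = new a , old (tgt G e) , gain G e
  ... | just (false , a) = old (src G e) , new a , gain G e
  edge : Fin (nE G + j) → Fin (nV G + k) × Fin (nV G + k) × Γ
  edge e = [ oldEdge , newE ]′ (splitAt (nE G) e)

ValidChoice : (G : GainGraph) → Fin (nV G) → ∀ {k} → (Fin (nE G) → Maybe (Bool × Fin k)) → Set
ValidChoice G v₁ ch =
  ∀ e b a → ch e ≡ just (b , a) → (if b then src G e else tgt G e) ≡ v₁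

k4a k4b : Fin 6 → Fin 4
k4a zero = zero
k4a (suc zero) = zero
k4a (suc (suc zero)) = zero
k4a (suc (suc (suc zero))) = suc zero
k4a (suc (suc (suc (suc zero)))) = suc zero
k4a (suc (suc (suc (suc (suc zero))))) = suc (suc zero)
k4b zero = suc zero
k4b (suc zero) = suc (suc zero)
k4b (suc (suc zero)) = suc (suc (suc zero))
k4b (suc (suc (suc zero))) = suc (suc zero)
k4b (suc (suc (suc (suc zero)))) = suc (suc (suc zero))
k4b (suc (suc (suc (suc (suc zero))))) = suc (suc (suc zero))

vertexToK4 : (H : GainGraph) → Fin (nV H) → (Fin (nE H) → Maybe (Bool × Fin 3)) → GainGraph
vertexToK4 H v₁ ch = extend H 3 6 newE ch
  where
  corner : Fin 4 → Fin (nV H + 3)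
  corner zero    = v₁ ↑ˡ 3
  corner (suc a) = nV H ↑ʳ a
  newE : Fin 6 → Fin (nV H + 3) × Fin (nV H + 3) × Γ
  newE i = corner (k4a i) , corner (k4b i) , ε

vertexToC4 : (H : GainGraph) → Fin (nV H) → Fin (nV H) → Γ → Γ →
             (Fin (nE H) → Maybe Bool) → GainGraph
vertexToC4 H v₂ v₃ g₀₂ g₀₃ ch = extend H 1 2 newE ch'
  where
  v₀ : Fin (nV H + 1)
  v₀ = nV H ↑ʳ zero
  newE : Fin 2 → Fin (nV H + 1) × Fin (nV H + 1) × Γ
  newE zero    = v₀ , v₂ ↑ˡ 1 , g₀₂
  newE (suc _) = v₀ , v₃ ↑ˡ 1 , g₀₃
  ch' : Fin (nE H) → Maybe (Bool × Fin 1)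
  ch' e with ch e
  ... | nothing = nothing
  ... | just b  = just (b , zero)

EdgeFrom : (G : GainGraph) → Fin (nE G) → Fin (nV G) → Fin (nV G) → Γ → Set
EdgeFrom G e v₁ w g =
  (src G e ≡ v₁ × tgt G e ≡ w × gain G e ≡ g)
  ⊎ (src G e ≡ w × tgt G e ≡ v₁ × gain G e ≡ g ⁻¹)

K4ToVertex : GainGraph → GainGraph → Set
K4ToVertex G H =
  Σ (Fin (nV H)) λ v₁ → Σ (Fin (nE H) → Maybe (Bool × Fin 3)) λ ch →
  ValidChoice H v₁ ch × Equivalent (vertexToK4 H v₁ ch) G

C4ToVertex : GainGraph → GainGraph → Set
C4ToVertex G H =
  Σ (Fin (nV H)) λ v₁ → Σ (Fin (nV H)) λ v₂ → Σ (Fin (nV H)) λ v₃ →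
  Σ (Fin (nE H)) λ e₁₂ → Σ (Fin (nE H)) λ e₁₃ →
  Σ Γ λ g₁₂ → Σ Γ λ g₁₃ → Σ Γ λ g₀₂ → Σ Γ λ g₀₃ →
  Σ (Fin (nE H) → Maybe Bool) λ ch →
  EdgeFrom H e₁₂ v₁ v₂ g₁₂ × EdgeFrom H e₁₃ v₁ v₃ g₁₃ × v₂ ≢ v₃ ×
  ((g₀₂ ⁻¹) · g₀₃ ≡ (g₁₂ ⁻¹) · g₁₃) ×
  ValidChoice H v₁ {1} (λ e → Data.Maybe.map (λ b → b , zero) (ch e)) ×
  ch e₁₂ ≡ nothing × ch e₁₃ ≡ nothing ×
  Equivalent (vertexToC4 H v₂ v₃ g₀₂ g₀₃ ch) G

-- Let v a, v b, v c be the neighbours of v₀ = v 0; as v₀ has degree 3, its K₄ edges are all its edges.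
-- Delete v₀ with its edges to v b and v c, and turn its edge to v a into a loop at v a whose gain γ is a
-- reflection occurring nowhere in G. After switching G at v₀ so that the edge v₀ v a carries γ, G is
-- recovered from this H by a vertex-to-4-cycle move at v a along the edges to v b and v c that moves one
-- end of the loop to the new vertex; the gain condition of the move is the balance of the K₄. A purely periodic subgraph of H cannot contain the reflection loop, so it is one of G. A
-- subgraph of H through the loop with |E| ≥ 2|V| becomes a violation of sparsity in G once v₀, its three
-- edges and (if missing) one of v b, v c with two K₄ edges are added, unless it misses both v b and v c: it
-- is then a tight subgraph of G meeting the K₄ only in v a, a blocker at a. Blockers at 1 and at 2 cannot
-- coexist (their union with v 0, v 3 and the six K₄ edges is too dense), so a = 1 or a = 2 works.

module Submission where

open import Defs
open import Data.Bool using (Bool)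
open import Data.Fin using (Fin; zero; suc)
open import Data.Maybe using (Maybe)
open import Data.Nat using (ℕ; zero; suc; _≤_; _<_; s≤s)
open import Data.Product using (Σ; _×_; proj₁)
open import Data.Sum using (_⊎_)
open import Relation.Binary.PropositionalEquality using (_≡_; subst)
open import Relation.Nullary using (yes; no; contradiction)

module GainGroup where

  open import Algebra.Bundles using (Group)
  open import Algebra.Structures using (IsGroup)
  open import Data.Bool using (true; false; not)
  open import Data.Integer using (ℤ; -_) renaming (_+_ to _+ℤ_)
  import Data.Integer.Properties as ℤ
  open import Data.Product using (_,_)
  open import Level using (0ℓ)
  open import Relation.Binary.PropositionalEquality

  private
    ⟨⟩-cong : ∀ {σ σ' : Bool} {c c' d d' : ℤ} → σ ≡ σ' → c ≡ c' → d ≡ d' →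
              ⟨ σ , c , d ⟩ ≡ ⟨ σ' , c' , d' ⟩
    ⟨⟩-cong refl refl refl = refl

    not-involutive : ∀ b → b ≡ not (not b)
    not-involutive true  = refl
    not-involutive false = refl

  ·-assoc : ∀ a b c → (a · b) · c ≡ a · (b · c)
  ·-assoc ⟨ true , c₁ , d₁ ⟩ ⟨ true , c₂ , d₂ ⟩ ⟨ σ₃ , c₃ , d₃ ⟩ =
    ⟨⟩-cong (not-involutive σ₃) (ℤ.+-assoc c₁ c₂ c₃) (begin
      d₁ +ℤ - d₂ +ℤ d₃         ≡⟨ ℤ.+-assoc d₁ (- d₂) d₃ ⟩
      d₁ +ℤ (- d₂ +ℤ d₃)       ≡⟨ cong (λ x → d₁ +ℤ (- d₂ +ℤ x)) (sym (ℤ.neg-involutive d₃)) ⟩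
      d₁ +ℤ (- d₂ +ℤ - - d₃)   ≡⟨ cong (d₁ +ℤ_) (sym (ℤ.neg-distrib-+ d₂ (- d₃))) ⟩
      d₁ +ℤ - (d₂ +ℤ - d₃)     ∎)
    where open ≡-Reasoning
  ·-assoc ⟨ true , c₁ , d₁ ⟩ ⟨ false , c₂ , d₂ ⟩ ⟨ σ₃ , c₃ , d₃ ⟩ =
    ⟨⟩-cong refl (ℤ.+-assoc c₁ c₂ c₃)
      (trans (ℤ.+-assoc d₁ (- d₂) (- d₃)) (cong (d₁ +ℤ_) (sym (ℤ.neg-distrib-+ d₂ d₃))))
  ·-assoc ⟨ false , c₁ , d₁ ⟩ ⟨ true , c₂ , d₂ ⟩ ⟨ σ₃ , c₃ , d₃ ⟩ =
    ⟨⟩-cong refl (ℤ.+-assoc c₁ c₂ c₃) (ℤ.+-assoc d₁ d₂ _)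
  ·-assoc ⟨ false , c₁ , d₁ ⟩ ⟨ false , c₂ , d₂ ⟩ ⟨ σ₃ , c₃ , d₃ ⟩ =
    ⟨⟩-cong refl (ℤ.+-assoc c₁ c₂ c₃) (ℤ.+-assoc d₁ d₂ _)

  ·-identityˡ : ∀ a → ε · a ≡ a
  ·-identityˡ ⟨ σ , c , d ⟩ = ⟨⟩-cong refl (ℤ.+-identityˡ c) (ℤ.+-identityˡ d)

  ·-identityʳ : ∀ a → a · ε ≡ a
  ·-identityʳ ⟨ true  , c , d ⟩ = ⟨⟩-cong refl (ℤ.+-identityʳ c) (ℤ.+-identityʳ d)
  ·-identityʳ ⟨ false , c , d ⟩ = ⟨⟩-cong refl (ℤ.+-identityʳ c) (ℤ.+-identityʳ d)

  ·-inverseˡ : ∀ a → (a ⁻¹) · a ≡ ε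
  ·-inverseˡ ⟨ true  , c , d ⟩ = ⟨⟩-cong refl (ℤ.+-inverseˡ c) (ℤ.+-inverseʳ d)
  ·-inverseˡ ⟨ false , c , d ⟩ = ⟨⟩-cong refl (ℤ.+-inverseˡ c) (ℤ.+-inverseˡ d)

  ·-inverseʳ : ∀ a → a · (a ⁻¹) ≡ ε
  ·-inverseʳ ⟨ true  , c , d ⟩ = ⟨⟩-cong refl (ℤ.+-inverseʳ c) (ℤ.+-inverseʳ d)
  ·-inverseʳ ⟨ false , c , d ⟩ = ⟨⟩-cong refl (ℤ.+-inverseʳ c) (ℤ.+-inverseʳ d)

  Γ-isGroup : IsGroup _≡_ _·_ ε _⁻¹
  Γ-isGroup = record
    { isMonoid = record
      { isSemigroup = record
        { isMagma = record { isEquivalence = isEquivalence ; ∙-cong = cong₂ _·_ }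
        ; assoc = ·-assoc }
      ; identity = ·-identityˡ , ·-identityʳ }
    ; inverse = ·-inverseˡ , ·-inverseʳ
    ; ⁻¹-cong = cong _⁻¹ }

  Γ-group : Group 0ℓ 0ℓ
  Γ-group = record { isGroup = Γ-isGroup }

  ·-cancel-middle : ∀ x y z → (x · (y ⁻¹)) · (y · z) ≡ x · z
  ·-cancel-middle x y z = begin
    (x · (y ⁻¹)) · (y · z)   ≡⟨ ·-assoc x (y ⁻¹) (y · z) ⟩
    x · ((y ⁻¹) · (y · z))   ≡⟨ cong (x ·_) (sym (·-assoc (y ⁻¹) y z)) ⟩
    x · (((y ⁻¹) · y) · z)   ≡⟨ cong (λ w → x · (w · z)) (·-inverseˡ y) ⟩
    x · (ε · z)              ≡⟨ cong (x ·_) (·-identityˡ z) ⟩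
    x · z                    ∎
    where open ≡-Reasoning

module SubsetCount where

  open import Data.Bool using (true; false)
  open import Data.Nat using (_+_)
  open import Data.Nat.Properties using (+-suc; +-comm; +-assoc)
  open import Data.Fin using (punchIn)
  open import Data.Fin.Subset
  open import Data.Fin.Subset.Properties
    using (p─⊥≡p; x∈p∪q⁻; x∈p∪q⁺; x∈⁅y⁆⇒x≡y; x∈⁅x⁆; p─q⊆p; ∪-identityʳ)
  open import Data.Vec using ([]; _∷_; insertAt)
  import Data.Vec as Vec
  open import Data.Vec.Properties using ([]=⇒lookup; lookup⇒[]=; insertAt-punchIn; insertAt-lookup)
  open import Data.List using (List; []; _∷_; length)
  open import Data.List.Membership.Propositional using () renaming (_∈_ to _∈ₗ_)
  open import Data.List.Relation.Unary.All as All using (All; []; _∷_)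
  open import Data.List.Relation.Unary.Any using (here; there)
  open import Data.List.Relation.Unary.Unique.Propositional using (Unique; []; _∷_)
  open import Data.Sum using (inj₁; inj₂)
  open import Data.Product using (_,_)
  open import Relation.Binary.PropositionalEquality

  private variable n : ℕ

  ∣b∷p∣≡ind+∣p∣ : ∀ b (p : Subset n) → ∣ b ∷ p ∣ ≡ ind b + ∣ p ∣
  ∣b∷p∣≡ind+∣p∣ true  p = refl
  ∣b∷p∣≡ind+∣p∣ false p = refl

  ∣insertAt∣≡ind+∣p∣ : ∀ (p : Subset n) i b → ∣ insertAt p i b ∣ ≡ ind b + ∣ p ∣
  ∣insertAt∣≡ind+∣p∣ p       zero    b = ∣b∷p∣≡ind+∣p∣ b p
  ∣insertAt∣≡ind+∣p∣ (x ∷ p) (suc i) b = begin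
    ∣ x ∷ insertAt p i b ∣     ≡⟨ ∣b∷p∣≡ind+∣p∣ x (insertAt p i b) ⟩
    ind x + ∣ insertAt p i b ∣ ≡⟨ cong (ind x +_) (∣insertAt∣≡ind+∣p∣ p i b) ⟩
    ind x + (ind b + ∣ p ∣)    ≡⟨ sym (+-assoc (ind x) _ _) ⟩
    (ind x + ind b) + ∣ p ∣    ≡⟨ cong (_+ ∣ p ∣) (+-comm (ind x) (ind b)) ⟩
    (ind b + ind x) + ∣ p ∣    ≡⟨ +-assoc (ind b) _ _ ⟩
    ind b + (ind x + ∣ p ∣)    ≡⟨ cong (ind b +_) (sym (∣b∷p∣≡ind+∣p∣ x p)) ⟩
    ind b + ∣ x ∷ p ∣          ∎
    where open ≡-Reasoning

  ∣p∪q∣+∣p∩q∣≡∣p∣+∣q∣ : ∀ (p q : Subset n) → ∣ p ∪ q ∣ + ∣ p ∩ q ∣ ≡ ∣ p ∣ + ∣ q ∣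
  ∣p∪q∣+∣p∩q∣≡∣p∣+∣q∣ []          []          = refl
  ∣p∪q∣+∣p∩q∣≡∣p∣+∣q∣ (true ∷ p)  (true ∷ q)  =
    cong suc (trans (+-suc _ _) (trans (cong suc (∣p∪q∣+∣p∩q∣≡∣p∣+∣q∣ p q)) (sym (+-suc _ _))))
  ∣p∪q∣+∣p∩q∣≡∣p∣+∣q∣ (true ∷ p)  (false ∷ q) = cong suc (∣p∪q∣+∣p∩q∣≡∣p∣+∣q∣ p q)
  ∣p∪q∣+∣p∩q∣≡∣p∣+∣q∣ (false ∷ p) (true ∷ q)  =
    trans (cong suc (∣p∪q∣+∣p∩q∣≡∣p∣+∣q∣ p q)) (sym (+-suc _ _))
  ∣p∪q∣+∣p∩q∣≡∣p∣+∣q∣ (false ∷ p) (false ∷ q) = ∣p∪q∣+∣p∩q∣≡∣p∣+∣q∣ p q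

  ∣p∪⁅x⁆∣≡1+∣p∣ : ∀ (p : Subset n) {x} → x ∉ p → ∣ p ∪ ⁅ x ⁆ ∣ ≡ suc ∣ p ∣
  ∣p∪⁅x⁆∣≡1+∣p∣ (true ∷ p)  {zero}  x∉p = contradiction Vec.here x∉p
  ∣p∪⁅x⁆∣≡1+∣p∣ (false ∷ p) {zero}  x∉p = cong (λ q → suc ∣ q ∣) (∪-identityʳ p)
  ∣p∪⁅x⁆∣≡1+∣p∣ (true ∷ p)  {suc x} x∉p = cong suc (∣p∪⁅x⁆∣≡1+∣p∣ p (λ x∈p → x∉p (Vec.there x∈p)))
  ∣p∪⁅x⁆∣≡1+∣p∣ (false ∷ p) {suc x} x∉p = ∣p∪⁅x⁆∣≡1+∣p∣ p (λ x∈p → x∉p (Vec.there x∈p))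

  ∣p∣≡1+∣p-x∣ : ∀ (p : Subset n) {x} → x ∈ p → ∣ p ∣ ≡ suc ∣ p - x ∣
  ∣p∣≡1+∣p-x∣ (true ∷ p)  {zero}  Vec.here        = cong (λ q → suc ∣ q ∣) (sym (p─⊥≡p p))
  ∣p∣≡1+∣p-x∣ (true ∷ p)  {suc x} (Vec.there x∈p) = cong suc (∣p∣≡1+∣p-x∣ p x∈p)
  ∣p∣≡1+∣p-x∣ (false ∷ p) {suc x} (Vec.there x∈p) = ∣p∣≡1+∣p-x∣ p x∈p

  x∈p∪⁅y⁆⁻ : ∀ (p : Subset n) y {x} → x ∈ p ∪ ⁅ y ⁆ → x ∈ p ⊎ x ≡ y
  x∈p∪⁅y⁆⁻ p y x∈ with x∈p∪q⁻ p ⁅ y ⁆ x∈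
  ... | inj₁ x∈p = inj₁ x∈p
  ... | inj₂ x∈y = inj₂ (x∈⁅y⁆⇒x≡y y x∈y)

  x∈p⇒x∈p∪⁅y⁆ : ∀ {p : Subset n} {x} y → x ∈ p → x ∈ p ∪ ⁅ y ⁆
  x∈p⇒x∈p∪⁅y⁆ y x∈p = x∈p∪q⁺ (inj₁ x∈p)

  y∈p∪⁅y⁆ : ∀ (p : Subset n) y → y ∈ p ∪ ⁅ y ⁆
  y∈p∪⁅y⁆ p y = x∈p∪q⁺ (inj₂ (x∈⁅x⁆ y))

  x∈p─q⇒x∉q : ∀ (p q : Subset n) {x} → x ∈ p ─ q → x ∉ q
  x∈p─q⇒x∉q (_ ∷ p) (true ∷ q)  {zero}  ()
  x∈p─q⇒x∉q (_ ∷ p) (false ∷ q) {zero}  _           ()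
  x∈p─q⇒x∉q (_ ∷ p) (_ ∷ q)     {suc x} (Vec.there x∈) (Vec.there x∈q) = x∈p─q⇒x∉q p q x∈ x∈q

  x∈p-y⁻ : ∀ {p : Subset n} {x y} → x ∈ p - y → x ∈ p × x ≢ y
  x∈p-y⁻ {p = p} {x} {y} x∈ = p─q⊆p p ⁅ y ⁆ x∈ , λ x≡y → x∈p─q⇒x∉q p ⁅ y ⁆ x∈ (subst (_∈ ⁅ y ⁆) (sym x≡y) (x∈⁅x⁆ y))

  punchIn∈insertAt⁻ : ∀ (p : Subset n) i b {j} → punchIn i j ∈ insertAt p i b → j ∈ p
  punchIn∈insertAt⁻ p i b {j} j∈ = lookup⇒[]= j p (trans (sym (insertAt-punchIn p i b j)) ([]=⇒lookup j∈))

  punchIn∈insertAt⁺ : ∀ (p : Subset n) i b {j} → j ∈ p → punchIn i j ∈ insertAt p i b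
  punchIn∈insertAt⁺ p i b {j} j∈ = lookup⇒[]= _ _ (trans (insertAt-punchIn p i b j) ([]=⇒lookup j∈))

  i∈insertAt-inside : ∀ (p : Subset n) i → i ∈ insertAt p i true
  i∈insertAt-inside p i = lookup⇒[]= i _ (insertAt-lookup p i true)

  i∉insertAt-outside : ∀ (p : Subset n) i → i ∉ insertAt p i false
  i∉insertAt-outside p i i∈ with trans (sym (insertAt-lookup p i false)) ([]=⇒lookup i∈)
  ... | ()

  addAll : Subset n → List (Fin n) → Subset n
  addAll p []       = p
  addAll p (x ∷ xs) = addAll p xs ∪ ⁅ x ⁆

  ∈-addAll⁻ : ∀ (p : Subset n) xs {y} → y ∈ addAll p xs → y ∈ p ⊎ y ∈ₗ xs
  ∈-addAll⁻ p []       y∈ = inj₁ y∈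
  ∈-addAll⁻ p (x ∷ xs) y∈ with x∈p∪⁅y⁆⁻ (addAll p xs) x y∈
  ... | inj₂ refl = inj₂ (here refl)
  ... | inj₁ y∈′ with ∈-addAll⁻ p xs y∈′
  ...   | inj₁ y∈p  = inj₁ y∈p
  ...   | inj₂ y∈xs = inj₂ (there y∈xs)

  ∈-addAll⁺ˡ : ∀ {p : Subset n} xs {y} → y ∈ p → y ∈ addAll p xs
  ∈-addAll⁺ˡ []       y∈p = y∈p
  ∈-addAll⁺ˡ (x ∷ xs) y∈p = x∈p⇒x∈p∪⁅y⁆ x (∈-addAll⁺ˡ xs y∈p)

  ∈-addAll⁺ʳ : ∀ (p : Subset n) {xs y} → y ∈ₗ xs → y ∈ addAll p xs
  ∈-addAll⁺ʳ p {x ∷ xs} (here refl) = y∈p∪⁅y⁆ (addAll p xs) x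
  ∈-addAll⁺ʳ p {x ∷ xs} (there y∈)  = x∈p⇒x∈p∪⁅y⁆ x (∈-addAll⁺ʳ p y∈)

  ∣addAll∣≡length+∣p∣ : ∀ (p : Subset n) xs → Unique xs → All (_∉ p) xs →
                        ∣ addAll p xs ∣ ≡ length xs + ∣ p ∣
  ∣addAll∣≡length+∣p∣ p []       []            []          = refl
  ∣addAll∣≡length+∣p∣ p (x ∷ xs) (x≢xs ∷ uniq) (x∉p ∷ xs∉p) =
    trans (∣p∪⁅x⁆∣≡1+∣p∣ (addAll p xs) x∉) (cong suc (∣addAll∣≡length+∣p∣ p xs uniq xs∉p))
    where
    x∉ : x ∉ addAll p xs
    x∉ x∈ with ∈-addAll⁻ p xs x∈
    ... | inj₁ x∈p  = x∉p x∈p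
    ... | inj₂ x∈xs = All.lookup x≢xs x∈xs refl

  x∉p∪q : ∀ {p q : Subset n} {x} → x ∉ p → x ∉ q → x ∉ p ∪ q
  x∉p∪q {p = p} {q} x∉p x∉q x∈ with x∈p∪q⁻ p q x∈
  ... | inj₁ x∈p = x∉p x∈p
  ... | inj₂ x∈q = x∉q x∈q

module Counting where

  open import Data.Bool using (true; false)
  open import Data.Nat
  open import Data.Nat.Properties
  open import Data.Fin.Subset using (Subset; _∈_; ∣_∣)
  open import Data.Vec using ([]; _∷_; here; there)
  open import Data.Nat.Tactic.RingSolver using (solve-∀)
  open import Relation.Nullary using (¬_)
  open import Relation.Binary.PropositionalEquality

  ∣S∣≤sumFin : ∀ {n} (S : Subset n) (f : Fin n → ℕ) → (∀ {i} → i ∈ S → 1 ≤ f i) → ∣ S ∣ ≤ sumFin f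
  ∣S∣≤sumFin []          f pos = z≤n
  ∣S∣≤sumFin (true ∷ S)  f pos = +-mono-≤ (pos here) (∣S∣≤sumFin S (λ i → f (suc i)) (λ i∈ → pos (there i∈)))
  ∣S∣≤sumFin (false ∷ S) f pos =
    ≤-trans (∣S∣≤sumFin S (λ i → f (suc i)) (λ i∈ → pos (there i∈))) (m≤n+m _ (f zero))

  f≤sumFin : ∀ {n} (f : Fin n → ℕ) i → f i ≤ sumFin f
  f≤sumFin f zero    = m≤m+n (f zero) _
  f≤sumFin f (suc i) = ≤-trans (f≤sumFin (λ j → f (suc j)) i) (m≤n+m _ (f zero))

  sumFin≤n*c : ∀ {n} (f : Fin n → ℕ) {c} → (∀ i → f i ≤ c) → sumFin f ≤ n * c
  sumFin≤n*c {zero}  f bound = z≤n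
  sumFin≤n*c {suc n} f bound = +-mono-≤ (bound zero) (sumFin≤n*c (λ i → f (suc i)) (λ i → bound (suc i)))

  extension-¬sparse : ∀ {E V} i j c → 2 * V ≤ E + c → 2 * i + c ≤ j → ¬ (j + E + 1 ≤ 2 * (i + V))
  extension-¬sparse {E} {V} i j c dense few sparse = 1+n≰n (begin
    suc (E + j)     ≡⟨ cong suc (+-comm E j) ⟩
    suc (j + E)     ≡⟨ +-comm 1 (j + E) ⟩
    j + E + 1       ≤⟨ sparse ⟩
    2 * (i + V)     ≡⟨ *-distribˡ-+ 2 i V ⟩
    2 * i + 2 * V   ≤⟨ +-monoʳ-≤ (2 * i) dense ⟩
    2 * i + (E + c) ≡⟨ cong (2 * i +_) (+-comm E c) ⟩
    2 * i + (c + E) ≡⟨ sym (+-assoc (2 * i) c E) ⟩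
    2 * i + c + E   ≤⟨ +-monoˡ-≤ E few ⟩
    j + E           ≡⟨ +-comm j E ⟩
    E + j           ∎)
    where open ≤-Reasoning

  dense-union : ∀ {v₁ v₂ v∪ v∩ e₁ e₂ e∪ e∩} →
    e∪ + e∩ ≡ e₁ + e₂ → v∪ + v∩ ≡ v₁ + v₂ →
    2 * v₁ ≤ e₁ + 1 → 2 * v₂ ≤ e₂ + 1 → e∩ ≤ 2 * v∩ → 2 * v∪ ≤ e∪ + 2
  dense-union {v₁} {v₂} {v∪} {v∩} {e₁} {e₂} {e∪} {e∩} e≡ v≡ dense₁ dense₂ sparse∩ =
    +-cancelʳ-≤ (2 * v∩) _ _ (begin
      2 * v∪ + 2 * v∩          ≡⟨ sym (*-distribˡ-+ 2 v∪ v∩) ⟩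
      2 * (v∪ + v∩)            ≡⟨ cong (2 *_) v≡ ⟩
      2 * (v₁ + v₂)            ≡⟨ *-distribˡ-+ 2 v₁ v₂ ⟩
      2 * v₁ + 2 * v₂          ≤⟨ +-mono-≤ dense₁ dense₂ ⟩
      (e₁ + 1) + (e₂ + 1)      ≡⟨ regroup₁ e₁ e₂ ⟩
      (e₁ + e₂) + 2            ≡⟨ cong (_+ 2) (sym e≡) ⟩
      (e∪ + e∩) + 2            ≤⟨ +-monoˡ-≤ 2 (+-monoʳ-≤ e∪ sparse∩) ⟩
      (e∪ + 2 * v∩) + 2        ≡⟨ regroup₂ e∪ (2 * v∩) ⟩
      (e∪ + 2) + 2 * v∩        ∎)
    where
    open ≤-Reasoning
    regroup₁ : ∀ a b → (a + 1) + (b + 1) ≡ (a + b) + 2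
    regroup₁ = solve-∀
    regroup₂ : ∀ a b → (a + b) + 2 ≡ (a + 2) + b
    regroup₂ = solve-∀

module FinBijections where

  open import Data.Nat using (_+_)
  open import Data.Fin using (punchIn; punchOut; _≟_; _↑ˡ_; _↑ʳ_; splitAt; join)
  open import Data.Fin.Properties
    using (punchIn-punchOut; punchInᵢ≢i; punchIn-injective; splitAt-↑ˡ; splitAt-↑ʳ; join-splitAt)
  open import Data.Sum using (inj₁; inj₂; [_,_]′)
  open import Function.Bundles using (_↔_; mk↔ₛ′)
  open import Relation.Nullary using (Dec)
  open import Relation.Binary.PropositionalEquality

  data PunchInView {n} (p : Fin (suc n)) : Fin (suc n) → Set where
    pivot   : PunchInView p p
    punched : ∀ j → PunchInView p (punchIn p j)

  punchInView : ∀ {n} (p x : Fin (suc n)) → PunchInView p x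
  punchInView p x with p ≟ x
  ... | yes refl = pivot
  ... | no p≢x   = subst (PunchInView p) (punchIn-punchOut p≢x) (punched (punchOut p≢x))

  data SplitView (m n : ℕ) : Fin (m + n) → Set where
    left  : ∀ i → SplitView m n (i ↑ˡ n)
    right : ∀ j → SplitView m n (m ↑ʳ j)

  splitView : ∀ m n x → SplitView m n x
  splitView m n x = view (splitAt m x) (join-splitAt m n x)
    where
    view : ∀ y → join m n y ≡ x → SplitView m n x
    view (inj₁ i) refl = left i
    view (inj₂ j) refl = right j

  module _ {m : ℕ} (p : Fin (suc m)) where

    punchInOrPivot : Fin (m + 1) → Fin (suc m)
    punchInOrPivot x = [ punchIn p , (λ _ → p) ]′ (splitAt m x)

    punchInOrPivot-↑ˡ : ∀ i → punchInOrPivot (i ↑ˡ 1) ≡ punchIn p i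
    punchInOrPivot-↑ˡ i rewrite splitAt-↑ˡ m i 1 = refl

    punchInOrPivot-↑ʳ : punchInOrPivot (m ↑ʳ zero) ≡ p
    punchInOrPivot-↑ʳ rewrite splitAt-↑ʳ m 1 zero = refl

    private
      from′ : ∀ {y} → Dec (p ≡ y) → Fin (m + 1)
      from′ (yes _)  = m ↑ʳ zero
      from′ (no p≢y) = punchOut p≢y ↑ˡ 1

      from : Fin (suc m) → Fin (m + 1)
      from y = from′ (p ≟ y)

      to∘from : ∀ y → punchInOrPivot (from y) ≡ y
      to∘from y with p ≟ y
      ... | yes p≡y = trans punchInOrPivot-↑ʳ p≡y
      ... | no p≢y  = trans (punchInOrPivot-↑ˡ _) (punchIn-punchOut p≢y)

      from∘to : ∀ x → from (punchInOrPivot x) ≡ x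
      from∘to x with splitView m 1 x
      ... | left i = trans (cong from (punchInOrPivot-↑ˡ i)) (from-punchIn (p ≟ punchIn p i))
        where
        from-punchIn : (d : Dec (p ≡ punchIn p i)) → from′ d ≡ i ↑ˡ 1
        from-punchIn (yes p≡) = contradiction (sym p≡) (punchInᵢ≢i p i)
        from-punchIn (no p≢)  = cong (_↑ˡ 1) (punchIn-injective p _ _ (punchIn-punchOut p≢))
      ... | right zero = trans (cong from punchInOrPivot-↑ʳ) (from-pivot (p ≟ p))
        where
        from-pivot : (d : Dec (p ≡ p)) → from′ d ≡ m ↑ʳ zero
        from-pivot (yes _)  = refl
        from-pivot (no p≢p) = contradiction refl p≢p

    punchInOrPivot-↔ : Fin (m + 1) ↔ Fin (suc m)
    punchInOrPivot-↔ = mk↔ₛ′ punchInOrPivot from to∘from from∘to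

  module _ {k : ℕ} (p : Fin (suc (suc k))) (q : Fin (suc k)) where

    punchIn²OrPivots : Fin (k + 2) → Fin (suc (suc k))
    punchIn²OrPivots x = [ (λ i → punchIn p (punchIn q i)) , pivots ]′ (splitAt k x)
      where
      pivots : Fin 2 → Fin (suc (suc k))
      pivots zero    = p
      pivots (suc _) = punchIn p q

    punchIn²OrPivots-↑ˡ : ∀ i → punchIn²OrPivots (i ↑ˡ 2) ≡ punchIn p (punchIn q i)
    punchIn²OrPivots-↑ˡ i rewrite splitAt-↑ˡ k i 2 = refl

    punchIn²OrPivots-↑ʳ₀ : punchIn²OrPivots (k ↑ʳ zero) ≡ p
    punchIn²OrPivots-↑ʳ₀ rewrite splitAt-↑ʳ k 2 zero = refl

    punchIn²OrPivots-↑ʳ₁ : punchIn²OrPivots (k ↑ʳ suc zero) ≡ punchIn p q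
    punchIn²OrPivots-↑ʳ₁ rewrite splitAt-↑ʳ k 2 (suc zero) = refl

    private
      from″ : ∀ {y} → Dec (q ≡ y) → Fin (k + 2)
      from″ (yes _)  = k ↑ʳ suc zero
      from″ (no q≢y) = punchOut q≢y ↑ˡ 2

      from′ : ∀ {y} → Dec (p ≡ y) → Fin (k + 2)
      from′ (yes _)  = k ↑ʳ zero
      from′ (no p≢y) = from″ (q ≟ punchOut p≢y)

      from : Fin (suc (suc k)) → Fin (k + 2)
      from y = from′ (p ≟ y)

      to∘from : ∀ y → punchIn²OrPivots (from y) ≡ y
      to∘from y with p ≟ y
      ... | yes p≡y = trans punchIn²OrPivots-↑ʳ₀ p≡y
      ... | no p≢y with q ≟ punchOut p≢y
      ...   | yes q≡ = trans punchIn²OrPivots-↑ʳ₁ (trans (cong (punchIn p) q≡) (punchIn-punchOut p≢y))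
      ...   | no q≢  = trans (punchIn²OrPivots-↑ˡ _)
                         (trans (cong (punchIn p) (punchIn-punchOut q≢)) (punchIn-punchOut p≢y))

      from∘to : ∀ x → from (punchIn²OrPivots x) ≡ x
      from∘to x with splitView k 2 x
      ... | left i = trans (cong from (punchIn²OrPivots-↑ˡ i)) (from-old (p ≟ punchIn p (punchIn q i)))
        where
        from-old : (d : Dec (p ≡ punchIn p (punchIn q i))) → from′ d ≡ i ↑ˡ 2
        from-old (yes p≡) = contradiction (sym p≡) (punchInᵢ≢i p _)
        from-old (no p≢)  = from-old′ (q ≟ punchOut p≢)
          where
          out≡ : punchOut p≢ ≡ punchIn q i
          out≡ = punchIn-injective p _ _ (punchIn-punchOut p≢)
          from-old′ : (d : Dec (q ≡ punchOut p≢)) → from″ d ≡ i ↑ˡ 2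
          from-old′ (yes q≡) = contradiction (sym (trans q≡ out≡)) (punchInᵢ≢i q i)
          from-old′ (no q≢)  = cong (_↑ˡ 2) (punchIn-injective q _ _ (trans (punchIn-punchOut q≢) out≡))
      ... | right zero = trans (cong from punchIn²OrPivots-↑ʳ₀) (from-p (p ≟ p))
        where
        from-p : (d : Dec (p ≡ p)) → from′ d ≡ k ↑ʳ zero
        from-p (yes _)  = refl
        from-p (no p≢p) = contradiction refl p≢p
      ... | right (suc zero) = trans (cong from punchIn²OrPivots-↑ʳ₁) (from-pq (p ≟ punchIn p q))
        where
        from-pq : (d : Dec (p ≡ punchIn p q)) → from′ d ≡ k ↑ʳ suc zero
        from-pq (yes p≡) = contradiction (sym p≡) (punchInᵢ≢i p q)
        from-pq (no p≢)  = from-pq′ (q ≟ punchOut p≢)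
          where
          from-pq′ : (d : Dec (q ≡ punchOut p≢)) → from″ d ≡ k ↑ʳ suc zero
          from-pq′ (yes _)  = refl
          from-pq′ (no q≢)  = contradiction (sym (punchIn-injective p _ _ (punchIn-punchOut p≢))) q≢

    punchIn²OrPivots-↔ : Fin (k + 2) ↔ Fin (suc (suc k))
    punchIn²OrPivots-↔ = mk↔ₛ′ punchIn²OrPivots from to∘from from∘to

module Switching where

  open import Data.Fin using (_≟_)
  open import Relation.Binary.PropositionalEquality

  module _ {n : ℕ} (w : Fin n) (γ : Γ) {a b : Fin n} (x : Γ) where

    switchGain-away : a ≢ w → b ≢ w → switchGain w γ a b x ≡ x
    switchGain-away a≢w b≢w with a ≟ w | b ≟ w
    ... | yes a≡w | _       = contradiction a≡w a≢w
    ... | no _    | yes b≡w = contradiction b≡w b≢w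
    ... | no _    | no _    = refl

    switchGain-out : a ≡ w → b ≢ w → switchGain w γ a b x ≡ γ · x
    switchGain-out a≡w b≢w with a ≟ w | b ≟ w
    ... | no a≢w | _       = contradiction a≡w a≢w
    ... | yes _  | yes b≡w = contradiction b≡w b≢w
    ... | yes _  | no _    = refl

    switchGain-in : a ≢ w → b ≡ w → switchGain w γ a b x ≡ x · (γ ⁻¹)
    switchGain-in a≢w b≡w with a ≟ w | b ≟ w
    ... | yes a≡w | _      = contradiction a≡w a≢w
    ... | no _    | no b≢w = contradiction b≡w b≢w
    ... | no _    | yes _  = refl

module GraphBasics (G : GainGraph) where

  open Counting using (∣S∣≤sumFin; sumFin≤n*c)
  open SubsetCount using (addAll; ∈-addAll⁻; ∣addAll∣≡length+∣p∣)
  open GainGroup using (Γ-group; ·-identityʳ)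
  open import Algebra.Properties.Group Γ-group using (⁻¹-involutive)
  open import Data.Bool using (true; false)
  open import Data.Nat using (_+_; _*_; z≤n)
  open import Data.Nat.Properties using (m≤n+m; ≤-trans; ≤-refl; ≤-reflexive; m≤m+n; +-mono-≤)
  open import Data.Fin using (_≟_)
  open import Data.Fin.Properties using (all?)
  open import Data.Fin.Subset using (Subset; _∈_; ∣_∣; ⊥)
  open import Data.Fin.Subset.Properties using (_∈?_; ⊆⊤; ∉⊥; ∣⊥∣≡0)
  open import Data.List using ([]; _∷_)
  open import Data.List.Relation.Unary.All using ([]; _∷_)
  open import Data.List.Relation.Unary.Any using (here; there)
  open import Data.List.Relation.Unary.Unique.Propositional using ([]; _∷_)
  open import Data.Product using (_,_; proj₂)
  open import Data.Sum using (inj₁; inj₂)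
  open import Relation.Nullary using (does; Dec)
  open import Relation.Nullary.Decidable using (_×-dec_; _→-dec_)
  open import Relation.Binary.PropositionalEquality

  Incident : Fin (nE G) → Fin (nV G) → Set
  Incident e x = src G e ≡ x ⊎ tgt G e ≡ x

  ∣S∣≤degree : ∀ {v} (S : Subset (nE G)) → (∀ {e} → e ∈ S → Incident e v) → ∣ S ∣ ≤ degree G v
  ∣S∣≤degree {v} S incident = ∣S∣≤sumFin S _ (λ e∈ → positive _ (incident e∈))
    where
    positive : ∀ e → Incident e v → 1 ≤ ind (does (src G e ≟ v)) + ind (does (tgt G e ≟ v))
    positive e (inj₁ src≡) with src G e ≟ v
    ... | yes _    = s≤s z≤n
    ... | no src≢  = contradiction src≡ src≢
    positive e (inj₂ tgt≡) with tgt G e ≟ v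
    ... | yes _    = ≤-trans (s≤s z≤n) (m≤n+m 1 (ind (does (src G e ≟ v))))
    ... | no tgt≢  = contradiction tgt≡ tgt≢

  degree≤nE*2 : ∀ v → degree G v ≤ nE G * 2
  degree≤nE*2 v = sumFin≤n*c {nE G} _ (λ e → +-mono-≤ (ind≤1 (does (src G e ≟ v))) (ind≤1 (does (tgt G e ≟ v))))
    where
    ind≤1 : ∀ b → ind b ≤ 1
    ind≤1 true  = ≤-refl
    ind≤1 false = z≤n

  degree-3-incident : ∀ {v e₁ e₂ e₃} → degree G v ≡ 3 → e₁ ≢ e₂ → e₁ ≢ e₃ → e₂ ≢ e₃ →
    Incident e₁ v → Incident e₂ v → Incident e₃ v → ∀ e → Incident e v → e ≡ e₁ ⊎ e ≡ e₂ ⊎ e ≡ e₃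
  degree-3-incident {v} {e₁} {e₂} {e₃} deg e₁≢e₂ e₁≢e₃ e₂≢e₃ at₁ at₂ at₃ e at
    with e ≟ e₁ | e ≟ e₂ | e ≟ e₃
  ... | yes e≡ | _      | _      = inj₁ e≡
  ... | no _   | yes e≡ | _      = inj₂ (inj₁ e≡)
  ... | no _   | no _   | yes e≡ = inj₂ (inj₂ e≡)
  ... | no e≢₁ | no e≢₂ | no e≢₃ = contradiction (≤-trans 4≤degree (≤-reflexive deg)) λ { (s≤s (s≤s (s≤s ()))) }
    where
    edges = e₁ ∷ e₂ ∷ e₃ ∷ e ∷ []
    incident : ∀ {e′} → e′ ∈ addAll ⊥ edges → Incident e′ v
    incident e′∈ with ∈-addAll⁻ ⊥ edges e′∈
    ... | inj₁ e′∈⊥                                = contradiction e′∈⊥ ∉⊥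
    ... | inj₂ (here refl)                         = at₁
    ... | inj₂ (there (here refl))                 = at₂
    ... | inj₂ (there (there (here refl)))         = at₃
    ... | inj₂ (there (there (there (here refl)))) = at
    4≤degree : 4 ≤ degree G v
    4≤degree = subst (_≤ degree G v)
      (trans (∣addAll∣≡length+∣p∣ ⊥ edges
               ((e₁≢e₂ ∷ e₁≢e₃ ∷ ≢-sym e≢₁ ∷ []) ∷ (e₂≢e₃ ∷ ≢-sym e≢₂ ∷ []) ∷ (≢-sym e≢₃ ∷ []) ∷ [] ∷ [])
               (∉⊥ ∷ ∉⊥ ∷ ∉⊥ ∷ ∉⊥ ∷ []))
             (cong (4 +_) (∣⊥∣≡0 (nE G))))
      (∣S∣≤degree (addAll ⊥ edges) incident)

  incident∈ : ∀ {VS ES} → IsSubgraph G VS ES → ∀ {e x} → e ∈ ES → Incident e x → x ∈ VS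
  incident∈ sub e∈ (inj₁ refl) = proj₁ (sub _ e∈)
  incident∈ sub e∈ (inj₂ refl) = proj₂ (sub _ e∈)

  isSubgraph? : ∀ VS ES → Dec (IsSubgraph G VS ES)
  isSubgraph? VS ES = all? (λ e → (e ∈? ES) →-dec ((src G e ∈? VS) ×-dec (tgt G e ∈? VS)))

  sparse-count : Sparse 2 1 G → ∀ {VS ES} → IsSubgraph G VS ES → 1 ≤ ∣ ES ∣ → ∣ ES ∣ + 1 ≤ 2 * ∣ VS ∣
  sparse-count sparse {VS} {ES} sub = sparse VS ES sub ⊆⊤ ⊆⊤

  sparse⇒∣E∣≤2∣V∣ : Sparse 2 1 G → ∀ {VS ES} → IsSubgraph G VS ES → ∣ ES ∣ ≤ 2 * ∣ VS ∣
  sparse⇒∣E∣≤2∣V∣ sparse {VS} {ES} sub with ∣ ES ∣ in ∣ES∣≡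
  ... | zero  = z≤n
  ... | suc n = ≤-trans (m≤m+n (suc n) 1) (subst (λ e → e + 1 ≤ 2 * ∣ VS ∣) ∣ES∣≡
                  (sparse-count sparse sub (subst (1 ≤_) (sym ∣ES∣≡) (s≤s z≤n))))

  Joins-sym : ∀ {e a b} → Joins G e a b → Joins G e b a
  Joins-sym (inj₁ ends) = inj₂ ends
  Joins-sym (inj₂ ends) = inj₁ ends

  orientedGain : ∀ {e a b} → Joins G e a b → Γ
  orientedGain {e} (inj₁ _) = gain G e
  orientedGain {e} (inj₂ _) = gain G e ⁻¹

  orientedGain-sym : ∀ {e a b} (J : Joins G e a b) → orientedGain (Joins-sym J) ≡ orientedGain J ⁻¹
  orientedGain-sym (inj₁ _) = refl
  orientedGain-sym {e} (inj₂ _) = sym (⁻¹-involutive (gain G e))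

  Joins-incidentˡ : ∀ {e a b} → Joins G e a b → Incident e a
  Joins-incidentˡ (inj₁ (src≡ , _)) = inj₁ src≡
  Joins-incidentˡ (inj₂ (_ , tgt≡)) = inj₂ tgt≡

  Joins-incidentʳ : ∀ {e a b} → Joins G e a b → Incident e b
  Joins-incidentʳ J = Joins-incidentˡ (Joins-sym J)

  Joins-ends∈ : ∀ {e a b} → Joins G e a b → ∀ {VS} → a ∈ VS → b ∈ VS → src G e ∈ VS × tgt G e ∈ VS
  Joins-ends∈ (inj₁ (refl , refl)) a∈ b∈ = a∈ , b∈
  Joins-ends∈ (inj₂ (refl , refl)) a∈ b∈ = b∈ , a∈

  Joins-endpoint : ∀ {e a b c d} → Joins G e a b → Joins G e c d → a ≡ c ⊎ a ≡ d
  Joins-endpoint (inj₁ (refl , _)) (inj₁ (c≡ , _)) = inj₁ c≡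
  Joins-endpoint (inj₁ (refl , _)) (inj₂ (d≡ , _)) = inj₂ d≡
  Joins-endpoint (inj₂ (_ , refl)) (inj₁ (_ , d≡)) = inj₂ d≡
  Joins-endpoint (inj₂ (_ , refl)) (inj₂ (_ , c≡)) = inj₁ c≡

  walk-along : ∀ {e a b ES w} (J : Joins G e a b) → e ∈ ES → (rest : Walk G ES b w) →
               Σ (Walk G ES a w) λ walk → netGain walk ≡ orientedGain J · netGain rest
  walk-along {e} (inj₁ (refl , refl)) e∈ rest = fwd e e∈ rest , refl
  walk-along {e} (inj₂ (refl , refl)) e∈ rest = bwd e e∈ rest , refl

  private
    stay : ∀ {ES x y} → x ≡ y → Σ (Walk G ES x y) λ w → netGain w ≡ ε
    stay refl = [] , refl

  loop∈GainSpace : ∀ {ES} e → e ∈ ES → src G e ≡ tgt G e → GainSpace G ES (src G e) (gain G e)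
  loop∈GainSpace {ES} e e∈ loop with stay (sym loop)
  ... | back , back≡ε = subst (GainSpace G ES (src G e))
                          (trans (cong (gain G e ·_) back≡ε) (·-identityʳ (gain G e)))
                          (gen (fwd e e∈ back))

module CompleteFour (G : GainGraph) (v : Fin 4 → Fin (nV G)) (k4 : InducesBalancedK4 G v) where

  open GraphBasics G
  open GainGroup using (·-identityʳ)
  open import Data.Bool using (_∧_)
  open import Data.Fin.Properties using (all?; _≟_)
  open import Data.Fin.Subset using (_∈_)
  open import Data.Fin.Subset.Properties using (x∈p∪q⁺; x∈⁅x⁆; _∈?_)
  open import Data.Product using (_,_; proj₂)
  open import Data.Sum using (inj₁; inj₂)
  open import Data.Vec.Properties using (lookup⇒[]=; lookup∘tabulate)
  open import Relation.Binary.PropositionalEquality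
  open import Relation.Nullary using (Dec)
  open import Relation.Nullary.Decidable using (dec-true; from-yes; ¬?; _⊎-dec_; _×-dec_; _→-dec_)

  k4a≢k4b : ∀ i → k4a i ≢ k4b i
  k4a≢k4b zero                                = λ ()
  k4a≢k4b (suc zero)                          = λ ()
  k4a≢k4b (suc (suc zero))                    = λ ()
  k4a≢k4b (suc (suc (suc zero)))              = λ ()
  k4a≢k4b (suc (suc (suc (suc zero))))        = λ ()
  k4a≢k4b (suc (suc (suc (suc (suc zero))))) = λ ()

  k4-pairs-injective : ∀ i j →
    (k4a i ≡ k4a j × k4b i ≡ k4b j) ⊎ (k4a i ≡ k4b j × k4b i ≡ k4a j) → i ≡ j
  k4-pairs-injective = from-yes (all? λ i → all? λ j →
    (((k4a i ≟ k4a j) ×-dec (k4b i ≟ k4b j)) ⊎-dec ((k4a i ≟ k4b j) ×-dec (k4b i ≟ k4a j))) →-dec (i ≟ j))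

  distinct-exhaust : ∀ {a b c : Fin 4} → zero ≢ a → zero ≢ b → zero ≢ c → a ≢ b → a ≢ c → b ≢ c →
                     ∀ j → j ≡ zero ⊎ j ≡ a ⊎ j ≡ b ⊎ j ≡ c
  distinct-exhaust {a} {b} {c} = from-yes decide a b c
    where
    Exhausted : Fin 4 → Fin 4 → Fin 4 → Set
    Exhausted a b c = zero ≢ a → zero ≢ b → zero ≢ c → a ≢ b → a ≢ c → b ≢ c →
                      ∀ j → j ≡ zero ⊎ j ≡ a ⊎ j ≡ b ⊎ j ≡ c
    decide : Dec (∀ a b c → Exhausted a b c)
    decide = all? λ a → all? λ b → all? λ c →
      ¬? (zero ≟ a) →-dec ¬? (zero ≟ b) →-dec ¬? (zero ≟ c) →-dec ¬? (a ≟ b) →-dec ¬? (a ≟ c) →-dec ¬? (b ≟ c) →-dec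
      all? λ j → (j ≟ zero) ⊎-dec ((j ≟ a) ⊎-dec ((j ≟ b) ⊎-dec (j ≟ c)))

  v-injective : ∀ {i j} → v i ≡ v j → i ≡ j
  v-injective = proj₁ k4 _ _

  v-≢ : ∀ {i j} → i ≢ j → v i ≢ v j
  v-≢ i≢j vi≡vj = i≢j (v-injective vi≡vj)

  edge : (i j : Fin 4) → i ≢ j → Fin (nE G)
  edge i j i≢j = proj₁ (proj₁ (proj₂ (proj₂ (proj₂ k4)) i j i≢j))

  edge-joins : (i j : Fin 4) (i≢j : i ≢ j) → Joins G (edge i j i≢j) (v i) (v j)
  edge-joins i j i≢j = proj₂ (proj₁ (proj₂ (proj₂ (proj₂ k4)) i j i≢j))

  joins-≢ : ∀ {e e' i j k l} → Joins G e (v i) (v j) → Joins G e' (v k) (v l) → i ≢ k → i ≢ l → e ≢ e'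
  joins-≢ J J' i≢k i≢l refl with Joins-endpoint J J'
  ... | inj₁ i≡k = i≢k (v-injective i≡k)
  ... | inj₂ i≡l = i≢l (v-injective i≡l)

  k4Edge : Fin 6 → Fin (nE G)
  k4Edge i = edge (k4a i) (k4b i) (k4a≢k4b i)

  k4Edge-joins : ∀ i → Joins G (k4Edge i) (v (k4a i)) (v (k4b i))
  k4Edge-joins i = edge-joins (k4a i) (k4b i) (k4a≢k4b i)

  k4Edge-injective : ∀ {i j} → k4Edge i ≡ k4Edge j → i ≡ j
  k4Edge-injective {i} {j} eq = k4-pairs-injective i j (same-ends
    (Joins-endpoint (k4Edge-joins i) J′) (Joins-endpoint (Joins-sym (k4Edge-joins i)) J′))
    where
    J′ : Joins G (k4Edge i) (v (k4a j)) (v (k4b j))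
    J′ = subst (λ e → Joins G e _ _) (sym eq) (k4Edge-joins j)
    same-ends : v (k4a i) ≡ v (k4a j) ⊎ v (k4a i) ≡ v (k4b j) →
                v (k4b i) ≡ v (k4a j) ⊎ v (k4b i) ≡ v (k4b j) →
                (k4a i ≡ k4a j × k4b i ≡ k4b j) ⊎ (k4a i ≡ k4b j × k4b i ≡ k4a j)
    same-ends (inj₁ a≡a) (inj₂ b≡b) = inj₁ (v-injective a≡a , v-injective b≡b)
    same-ends (inj₂ a≡b) (inj₁ b≡a) = inj₂ (v-injective a≡b , v-injective b≡a)
    same-ends (inj₁ a≡a) (inj₁ b≡a) = contradiction (v-injective (trans a≡a (sym b≡a))) (k4a≢k4b i)
    same-ends (inj₂ a≡b) (inj₂ b≡b) = contradiction (v-injective (trans a≡b (sym b≡b))) (k4a≢k4b i)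

  v∈fourSet : ∀ i → v i ∈ fourSet v
  v∈fourSet zero                   = x∈p∪q⁺ (inj₁ (x∈⁅x⁆ _))
  v∈fourSet (suc zero)             = x∈p∪q⁺ (inj₂ (x∈p∪q⁺ (inj₁ (x∈⁅x⁆ _))))
  v∈fourSet (suc (suc zero))       = x∈p∪q⁺ (inj₂ (x∈p∪q⁺ (inj₂ (x∈p∪q⁺ (inj₁ (x∈⁅x⁆ _))))))
  v∈fourSet (suc (suc (suc zero))) = x∈p∪q⁺ (inj₂ (x∈p∪q⁺ (inj₂ (x∈p∪q⁺ (inj₂ (x∈⁅x⁆ _))))))

  joins⇒induced : ∀ {e i j} → Joins G e (v i) (v j) → e ∈ inducedEdges G (fourSet v)
  joins⇒induced {e} {i} {j} J = lookup⇒[]= e _ (trans (lookup∘tabulate _ e)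
    (cong₂ _∧_ (dec-true (_ ∈? fourSet v) (proj₁ ends)) (dec-true (_ ∈? fourSet v) (proj₂ ends))))
    where ends = Joins-ends∈ J (v∈fourSet i) (v∈fourSet j)

  cycle-balanced : ∀ {e₁ e₂ e₃ e₄ i j k l} (J₁ : Joins G e₁ (v i) (v j)) (J₂ : Joins G e₂ (v j) (v k))
                   (J₃ : Joins G e₃ (v k) (v l)) (J₄ : Joins G e₄ (v l) (v i)) →
                   orientedGain J₁ · (orientedGain J₂ · (orientedGain J₃ · orientedGain J₄)) ≡ ε
  cycle-balanced {i = i} J₁ J₂ J₃ J₄ =
    trans (sym net≡) (proj₁ (proj₂ k4) (v i) (v∈fourSet i) _ (gen (proj₁ w₁)))
    where
    w₄ = walk-along J₄ (joins⇒induced J₄) []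
    w₃ = walk-along J₃ (joins⇒induced J₃) (proj₁ w₄)
    w₂ = walk-along J₂ (joins⇒induced J₂) (proj₁ w₃)
    w₁ = walk-along J₁ (joins⇒induced J₁) (proj₁ w₂)
    net≡ : netGain (proj₁ w₁) ≡ orientedGain J₁ · (orientedGain J₂ · (orientedGain J₃ · orientedGain J₄))
    net≡ = trans (proj₂ w₁) (cong (orientedGain J₁ ·_) (trans (proj₂ w₂) (cong (orientedGain J₂ ·_)
             (trans (proj₂ w₃) (cong (orientedGain J₃ ·_) (trans (proj₂ w₄) (·-identityʳ _)))))))

module Obstruction (G : GainGraph) (sparse : Sparse 2 1 G) (v : Fin 4 → Fin (nV G)) (k4 : InducesBalancedK4 G v) where

  open GraphBasics G
  open CompleteFour G v k4
  open Counting using (extension-¬sparse; dense-union)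
  open SubsetCount
  open import Data.Fin using (_≟_)
  open import Data.Fin.Properties using (all?)
  open import Data.Fin.Subset using (Subset; _∈_; _∉_; ∣_∣; _∪_; _∩_)
  open import Data.Fin.Subset.Properties using (_∈?_; anySubset?; x∈p∪q⁻; x∈p∪q⁺; x∈p∩q⁺; x∈p∩q⁻)
  open import Data.List using (List; []; _∷_; map; allFin)
  open import Data.List.Membership.Propositional.Properties using (∈-map⁻)
  open import Data.List.Relation.Unary.All using ([]; _∷_)
  open import Data.List.Relation.Unary.All.Properties using (tabulate⁺) renaming (map⁺ to All-map⁺)
  open import Data.List.Relation.Unary.Any using (here; there)
  open import Data.List.Relation.Unary.Unique.Propositional using (Unique; []; _∷_)
  open import Data.List.Relation.Unary.Unique.Propositional.Properties using (allFin⁺) renaming (map⁺ to Unique-map⁺)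
  open import Data.Nat using (_+_; _*_; _≤?_; z≤n)
  open import Data.Nat.Properties using (≤-refl)
  open import Data.Product as Prod using (_,_; proj₁; proj₂)
  open import Data.Sum using (inj₁; inj₂)
  open import Function using (_∘_)
  open import Relation.Binary.PropositionalEquality
  open import Relation.Nullary using (¬_; Dec)
  open import Relation.Nullary.Decidable using (map′; _×-dec_; _→-dec_; ¬?)

  record Blocker (a : Fin 4) : Set where
    field
      vertices : Subset (nV G)
      edges    : Subset (nE G)
      subgraph : IsSubgraph G vertices edges
      meets    : v a ∈ vertices
      avoids   : ∀ j → j ≢ a → v j ∉ vertices
      dense    : 2 * ∣ vertices ∣ ≤ ∣ edges ∣ + 1

  blocker? : ∀ a → Dec (Blocker a)
  blocker? a = map′
    (λ (VS , ES , sub , meets , avoids , dense) → record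
       { vertices = VS ; edges = ES ; subgraph = sub ; meets = meets ; avoids = avoids ; dense = dense })
    (λ B → let open Blocker B in vertices , edges , subgraph , meets , avoids , dense)
    (anySubset? λ VS → anySubset? λ ES →
       isSubgraph? VS ES ×-dec (v a ∈? VS) ×-dec all? (λ j → ¬? (j ≟ a) →-dec ¬? (v j ∈? VS))
         ×-dec (2 * ∣ VS ∣ ≤? ∣ ES ∣ + 1))

  k4Edge∉ : ∀ {VS ES} → IsSubgraph G VS ES → ∀ {a} → (∀ j → j ≢ a → v j ∉ VS) → ∀ i → k4Edge i ∉ ES
  k4Edge∉ sub {a} avoids i e∈ with k4a i ≟ a
  ... | no  ≢a   = avoids _ ≢a (incident∈ sub e∈ (Joins-incidentˡ (k4Edge-joins i)))
  ... | yes refl = avoids _ (λ b≡a → k4a≢k4b i (sym b≡a)) (incident∈ sub e∈ (Joins-incidentʳ (k4Edge-joins i)))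

  blockers-exclusive : Blocker (suc zero) → ¬ Blocker (suc (suc zero))
  blockers-exclusive B₁ B₂ = extension-¬sparse 2 6 2 union-dense ≤-refl
    (subst₂ (λ e w → e + 1 ≤ 2 * w) ∣F∣ ∣W∣ (sparse-count sparse W-F-subgraph (subst (1 ≤_) (sym ∣F∣) (s≤s z≤n))))
    where
    module B₁ = Blocker B₁
    module B₂ = Blocker B₂
    V∪ = B₁.vertices ∪ B₂.vertices
    E∪ = B₁.edges ∪ B₂.edges

    ∩-subgraph : IsSubgraph G (B₁.vertices ∩ B₂.vertices) (B₁.edges ∩ B₂.edges)
    ∩-subgraph e e∈ with x∈p∩q⁻ B₁.edges B₂.edges e∈
    ... | e∈₁ , e∈₂ = x∈p∩q⁺ (proj₁ (B₁.subgraph e e∈₁) , proj₁ (B₂.subgraph e e∈₂))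
                    , x∈p∩q⁺ (proj₂ (B₁.subgraph e e∈₁) , proj₂ (B₂.subgraph e e∈₂))

    union-dense : 2 * ∣ V∪ ∣ ≤ ∣ E∪ ∣ + 2
    union-dense = dense-union {∣ B₁.vertices ∣} {∣ B₂.vertices ∣} {∣ V∪ ∣} {∣ B₁.vertices ∩ B₂.vertices ∣}
      (∣p∪q∣+∣p∩q∣≡∣p∣+∣q∣ B₁.edges B₂.edges) (∣p∪q∣+∣p∩q∣≡∣p∣+∣q∣ B₁.vertices B₂.vertices)
      B₁.dense B₂.dense (sparse⇒∣E∣≤2∣V∣ sparse ∩-subgraph)

    three : Fin 4
    three = suc (suc (suc zero))

    corners = v zero ∷ v three ∷ []
    W = addAll V∪ corners
    k4Edges = map k4Edge (allFin 6)
    F = addAll E∪ k4Edges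

    ∣W∣ : ∣ W ∣ ≡ 2 + ∣ V∪ ∣
    ∣W∣ = ∣addAll∣≡length+∣p∣ V∪ corners ((v-≢ (λ ()) ∷ []) ∷ [] ∷ [])
            ( x∉p∪q (B₁.avoids zero (λ ())) (B₂.avoids zero (λ ()))
            ∷ x∉p∪q (B₁.avoids three (λ ())) (B₂.avoids three (λ ())) ∷ [])

    ∣F∣ : ∣ F ∣ ≡ 6 + ∣ E∪ ∣
    ∣F∣ = ∣addAll∣≡length+∣p∣ E∪ k4Edges (Unique-map⁺ {f = k4Edge} k4Edge-injective (allFin⁺ 6))
            (All-map⁺ {f = k4Edge} (tabulate⁺ {f = λ i → i} λ i →
               x∉p∪q (k4Edge∉ B₁.subgraph B₁.avoids i) (k4Edge∉ B₂.subgraph B₂.avoids i)))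

    into : ∀ {x} → x ∈ B₁.vertices ⊎ x ∈ B₂.vertices → x ∈ W
    into x∈ = ∈-addAll⁺ˡ corners (x∈p∪q⁺ x∈)

    v∈W : ∀ i → v i ∈ W
    v∈W zero                   = ∈-addAll⁺ʳ V∪ {corners} (here refl)
    v∈W (suc zero)             = into (inj₁ B₁.meets)
    v∈W (suc (suc zero))       = into (inj₂ B₂.meets)
    v∈W (suc (suc (suc zero))) = ∈-addAll⁺ʳ V∪ {corners} (there (here refl))

    W-F-subgraph : IsSubgraph G W F
    W-F-subgraph e e∈ with ∈-addAll⁻ E∪ k4Edges e∈
    ... | inj₂ e∈k4 with ∈-map⁻ k4Edge {xs = allFin 6} e∈k4
    ...   | i , _ , refl = Joins-ends∈ (k4Edge-joins i) (v∈W (k4a i)) (v∈W (k4b i))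
    W-F-subgraph e e∈ | inj₁ e∈E∪ with x∈p∪q⁻ B₁.edges B₂.edges e∈E∪
    ...   | inj₁ e∈₁ = Prod.map (into ∘ inj₁) (into ∘ inj₁) (B₁.subgraph e e∈₁)
    ...   | inj₂ e∈₂ = Prod.map (into ∘ inj₂) (into ∘ inj₂) (B₂.subgraph e e∈₂)

module VertexToC4 (H : GainGraph) (v₂ v₃ : Fin (nV H)) (g₀₂ g₀₃ : Γ) (ch : Fin (nE H) → Maybe Bool) where

  open import Data.Nat using (_+_)
  open import Data.Bool using (true)
  open import Data.Fin using (_↑ˡ_; _↑ʳ_)
  open import Data.Fin.Properties using (splitAt-↑ˡ; splitAt-↑ʳ)
  open import Data.Maybe using (just; nothing)
  open import Data.Product using (_,_)
  open import Relation.Binary.PropositionalEquality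

  C : GainGraph
  C = vertexToC4 H v₂ v₃ g₀₂ g₀₃ ch

  v₀ : Fin (nV H + 1)
  v₀ = nV H ↑ʳ zero

  unchanged : ∀ i → ch i ≡ nothing →
    src C (i ↑ˡ 2) ≡ src H i ↑ˡ 1 × tgt C (i ↑ˡ 2) ≡ tgt H i ↑ˡ 1 × gain C (i ↑ˡ 2) ≡ gain H i
  unchanged i ch≡ rewrite splitAt-↑ˡ (nE H) i 2 | ch≡ = refl , refl , refl

  source-moved : ∀ i → ch i ≡ just true →
    src C (i ↑ˡ 2) ≡ v₀ × tgt C (i ↑ˡ 2) ≡ tgt H i ↑ˡ 1 × gain C (i ↑ˡ 2) ≡ gain H i
  source-moved i ch≡ rewrite splitAt-↑ˡ (nE H) i 2 | ch≡ = refl , refl , refl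

  new₂ : src C (nE H ↑ʳ zero) ≡ v₀ × tgt C (nE H ↑ʳ zero) ≡ v₂ ↑ˡ 1 × gain C (nE H ↑ʳ zero) ≡ g₀₂
  new₂ rewrite splitAt-↑ʳ (nE H) 2 zero = refl , refl , refl

  new₃ : src C (nE H ↑ʳ suc zero) ≡ v₀ × tgt C (nE H ↑ʳ suc zero) ≡ v₃ ↑ˡ 1 × gain C (nE H ↑ʳ suc zero) ≡ g₀₃
  new₃ rewrite splitAt-↑ʳ (nE H) 2 (suc zero) = refl , refl , refl

module Reduction (m k : ℕ) (s t : Fin (suc (suc k)) → Fin (suc m)) (g : Fin (suc (suc k)) → Γ) where

  open GainGroup using (Γ-group; ·-assoc; ·-inverseˡ; ·-identityʳ; ·-cancel-middle)
  open import Algebra.Properties.Group Γ-group using (⁻¹-involutive; ⁻¹-anti-homo-∙; inverseˡ-unique)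
  open Counting using (f≤sumFin; extension-¬sparse)
  open SubsetCount
  open FinBijections
  open Switching
  open import Data.Bool using (true; false; if_then_else_)
  open import Data.Nat using (_+_; _*_; z≤n)
  import Data.Nat.Properties as ℕ
  import Data.Integer as ℤ
  open import Data.Fin using (punchIn; punchOut; _≟_; _↑ˡ_; _↑ʳ_)
  open import Data.Fin.Properties using (punchIn-punchOut; punchInᵢ≢i; punchIn-injective)
  open import Data.Fin.Subset using (Subset; _∈_; _∉_; _⊆_; ∣_∣; _-_)
  open import Data.Fin.Subset.Properties using (_∈?_)
  open import Data.List using (List; []; _∷_; length)
  open import Data.List.Membership.Propositional using () renaming (_∈_ to _∈ₗ_)
  open import Data.List.Relation.Unary.All using (All; []; _∷_)
  open import Data.List.Relation.Unary.Any using (here; there)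
  open import Data.List.Relation.Unary.Unique.Propositional using (Unique; []; _∷_)
  open import Data.Maybe using (just; nothing)
  import Data.Maybe as Maybe
  open import Data.Vec using (insertAt)
  open import Data.Product using (_,_; proj₂)
  open import Data.Sum using (inj₁; inj₂)
  open import Data.Empty using () renaming (⊥ to Empty)
  open import Function using (_∘_)
  open import Relation.Binary.Construct.Closure.ReflexiveTransitive using (_◅_) renaming (ε to done)
  open import Relation.Nullary using (¬_; Dec; does)
  open import Relation.Nullary.Decidable using (dec-true; dec-false)
  open import Relation.Binary.PropositionalEquality

  G : GainGraph
  G = record { nV = suc m ; nE = suc (suc k) ; src = s ; tgt = t ; gain = g }

  module _ (gg : IsGainGraph G) (qt : QTight G) (v : Fin 4 → Fin (suc m))
           (deg : degree G (v zero) ≡ 3) (k4 : InducesBalancedK4 G v)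
           (a b c : Fin 4) (0≢a : zero ≢ a) (0≢b : zero ≢ b) (0≢c : zero ≢ c)
           (a≢b : a ≢ b) (a≢c : a ≢ c) (b≢c : b ≢ c)
           (unblocked : ¬ Obstruction.Blocker G (proj₁ (proj₁ qt)) v k4 a) where

    open GraphBasics G
    open CompleteFour G v k4

    sparse : Sparse 2 1 G
    sparse = proj₁ (proj₁ qt)

    v₀ va vb vc : Fin (suc m)
    v₀ = v zero
    va = v a
    vb = v b
    vc = v c

    e0a e0b e0c : Fin (suc (suc k))
    e0a = edge zero a 0≢a
    e0b = edge zero b 0≢b
    e0c = edge zero c 0≢c

    J0a = edge-joins zero a 0≢a
    J0b = edge-joins zero b 0≢b
    J0c = edge-joins zero c 0≢c
    Jab = edge-joins a b a≢b
    Jac = edge-joins a c a≢c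

    e0b≢e0a : e0b ≢ e0a
    e0b≢e0a = joins-≢ (Joins-sym J0b) J0a (≢-sym 0≢b) (≢-sym a≢b)
    e0b≢e0c : e0b ≢ e0c
    e0b≢e0c = joins-≢ (Joins-sym J0b) J0c (≢-sym 0≢b) b≢c
    e0a≢e0c : e0a ≢ e0c
    e0a≢e0c = joins-≢ (Joins-sym J0a) J0c (≢-sym 0≢a) a≢c

    at-v₀ : ∀ e → Incident e v₀ → e ≡ e0a ⊎ e ≡ e0b ⊎ e ≡ e0c
    at-v₀ = degree-3-incident deg (≢-sym e0b≢e0a) e0a≢e0c e0b≢e0c
              (Joins-incidentˡ J0a) (Joins-incidentˡ J0b) (Joins-incidentˡ J0c)

    q : Fin (suc k)
    q = punchOut e0b≢e0c

    kept : Fin k → Fin (suc (suc k))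
    kept j = punchIn e0b (punchIn q j)

    kept-injective : ∀ {i j} → kept i ≡ kept j → i ≡ j
    kept-injective eq = punchIn-injective q _ _ (punchIn-injective e0b _ _ eq)

    data EdgeView : Fin (suc (suc k)) → Set where
      dropped-b : EdgeView e0b
      dropped-c : EdgeView e0c
      kept-edge : ∀ j → EdgeView (kept j)

    edgeView : ∀ e → EdgeView e
    edgeView e with punchInView e0b e
    ... | pivot = dropped-b
    ... | punched y with punchInView q y
    ...   | pivot     = subst EdgeView (sym (punchIn-punchOut e0b≢e0c)) dropped-c
    ...   | punched j = kept-edge j

    kept⁻¹ : ∀ e → e ≢ e0b → e ≢ e0c → Σ (Fin k) λ j → kept j ≡ e
    kept⁻¹ e e≢b e≢c with edgeView e
    ... | dropped-b   = contradiction refl e≢b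
    ... | dropped-c   = contradiction refl e≢c
    ... | kept-edge j = j , refl

    ℓ : Fin k
    ℓ = proj₁ (kept⁻¹ e0a (≢-sym e0b≢e0a) e0a≢e0c)

    kept-ℓ : kept ℓ ≡ e0a
    kept-ℓ = proj₂ (kept⁻¹ e0a (≢-sym e0b≢e0a) e0a≢e0c)

    kept-avoids-v₀ : ∀ {j} → j ≢ ℓ → ¬ Incident (kept j) v₀
    kept-avoids-v₀ {j} j≢ℓ at with at-v₀ (kept j) at
    ... | inj₁ ≡e0a        = j≢ℓ (kept-injective (trans ≡e0a (sym kept-ℓ)))
    ... | inj₂ (inj₁ ≡e0b) = punchInᵢ≢i e0b _ ≡e0b
    ... | inj₂ (inj₂ ≡e0c) = punchInᵢ≢i q j (punchIn-injective e0b _ _ (trans ≡e0c (sym (punchIn-punchOut e0b≢e0c))))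

    kept-index : ∀ {e i j} → Joins G e (v i) (v j) → zero ≢ i → zero ≢ j →
                 Σ (Fin k) λ j′ → kept j′ ≡ e × j′ ≢ ℓ
    kept-index J 0≢i 0≢j
      with kept⁻¹ _ (λ { refl → joins-≢ J0b J 0≢i 0≢j refl }) (λ { refl → joins-≢ J0c J 0≢i 0≢j refl })
    ... | j′ , kept≡ = j′ , kept≡ , λ { refl →
            joins-≢ J0a (subst (λ e → Joins G e _ _) (trans (sym kept≡) kept-ℓ) J) 0≢i 0≢j refl }

    old : Fin m → Fin (suc m)
    old = punchIn v₀

    old-injective : ∀ {x y} → old x ≡ old y → x ≡ y
    old-injective = punchIn-injective v₀ _ _

    old≢v₀ : ∀ x → old x ≢ v₀
    old≢v₀ = punchInᵢ≢i v₀

    a′ b′ c′ : Fin m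
    a′ = punchOut (v-≢ 0≢a)
    b′ = punchOut (v-≢ 0≢b)
    c′ = punchOut (v-≢ 0≢c)

    old-a′ : old a′ ≡ va
    old-a′ = punchIn-punchOut (v-≢ 0≢a)
    old-b′ : old b′ ≡ vb
    old-b′ = punchIn-punchOut (v-≢ 0≢b)
    old-c′ : old c′ ≡ vc
    old-c′ = punchIn-punchOut (v-≢ 0≢c)

    -- lower v₀ is a junk value: H only lowers endpoints of edges not incident to v₀.
    lower : Fin (suc m) → Fin m
    lower x with v₀ ≟ x
    ... | yes _    = a′
    ... | no v₀≢x  = punchOut v₀≢x

    old-lower : ∀ {x} → x ≢ v₀ → old (lower x) ≡ x
    old-lower {x} x≢v₀ with v₀ ≟ x
    ... | yes v₀≡x = contradiction (sym v₀≡x) x≢v₀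
    ... | no v₀≢x  = punchIn-punchOut v₀≢x

    -- A reflection with a longer translation than any gain of G: the loop it labels has a gain new to G, and
    -- no purely periodic subgraph of H contains it.
    γ : Γ
    γ = ⟨ true , ℤ.+ suc (sumFin λ e → ℤ.∣ Γ.c (g e) ∣) , ℤ.0ℤ ⟩

    g≢γ : ∀ e → g e ≢ γ
    g≢γ e g≡γ = ℕ.<-irrefl (cong (λ x → ℤ.∣ Γ.c x ∣) g≡γ) (s≤s (f≤sumFin (λ e → ℤ.∣ Γ.c (g e) ∣) e))

    atLoop : ∀ {A : Set} → Fin k → A → A → A
    atLoop j x y = if does (j ≟ ℓ) then x else y

    atLoop-ℓ : ∀ {A : Set} {x y : A} → atLoop ℓ x y ≡ x
    atLoop-ℓ {x = x} {y} = cong (if_then x else y) (dec-true (ℓ ≟ ℓ) refl)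

    atLoop-≢ : ∀ {A : Set} {j} {x y : A} → j ≢ ℓ → atLoop j x y ≡ y
    atLoop-≢ {j = j} {x} {y} j≢ℓ = cong (if_then x else y) (dec-false (j ≟ ℓ) j≢ℓ)

    H : GainGraph
    H = record
      { nV   = m
      ; nE   = k
      ; src  = λ j → atLoop j a′ (lower (s (kept j)))
      ; tgt  = λ j → atLoop j a′ (lower (t (kept j)))
      ; gain = λ j → atLoop j γ (g (kept j))
      }

    src-ℓ : src H ℓ ≡ a′
    src-ℓ = atLoop-ℓ
    tgt-ℓ : tgt H ℓ ≡ a′
    tgt-ℓ = atLoop-ℓ
    gain-ℓ : gain H ℓ ≡ γ
    gain-ℓ = atLoop-ℓ

    src-kept : ∀ {j} → j ≢ ℓ → old (src H j) ≡ s (kept j)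
    src-kept j≢ℓ = trans (cong old (atLoop-≢ j≢ℓ)) (old-lower (λ s≡v₀ → kept-avoids-v₀ j≢ℓ (inj₁ s≡v₀)))
    tgt-kept : ∀ {j} → j ≢ ℓ → old (tgt H j) ≡ t (kept j)
    tgt-kept j≢ℓ = trans (cong old (atLoop-≢ j≢ℓ)) (old-lower (λ t≡v₀ → kept-avoids-v₀ j≢ℓ (inj₂ t≡v₀)))
    gain-kept : ∀ {j} → j ≢ ℓ → gain H j ≡ g (kept j)
    gain-kept = atLoop-≢

    H-isGainGraph : IsGainGraph H
    H-isGainGraph = parallel , loops
      where
      parallel : ∀ i j → i ≢ j → src H i ≡ src H j → tgt H i ≡ tgt H j → gain H i ≢ gain H j
      parallel i j i≢j src≡ tgt≡ gain≡ = cases (i ≟ ℓ) (j ≟ ℓ)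
        where
        cases : Dec (i ≡ ℓ) → Dec (j ≡ ℓ) → Empty
        cases (yes i≡ℓ) (yes j≡ℓ) = i≢j (trans i≡ℓ (sym j≡ℓ))
        cases (yes i≡ℓ) (no j≢ℓ)  =
          g≢γ (kept j) (trans (sym (gain-kept j≢ℓ)) (trans (sym gain≡) (trans (cong (gain H) i≡ℓ) gain-ℓ)))
        cases (no i≢ℓ)  (yes j≡ℓ) =
          g≢γ (kept i) (trans (sym (gain-kept i≢ℓ)) (trans gain≡ (trans (cong (gain H) j≡ℓ) gain-ℓ)))
        cases (no i≢ℓ)  (no j≢ℓ)  = proj₁ gg (kept i) (kept j) (λ eq → i≢j (kept-injective eq))
          (trans (sym (src-kept i≢ℓ)) (trans (cong old src≡) (src-kept j≢ℓ)))
          (trans (sym (tgt-kept i≢ℓ)) (trans (cong old tgt≡) (tgt-kept j≢ℓ)))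
          (trans (sym (gain-kept i≢ℓ)) (trans gain≡ (gain-kept j≢ℓ)))
      loops : ∀ j → src H j ≡ tgt H j → gain H j ≢ ε
      loops j src≡tgt gain≡ε = cases (j ≟ ℓ)
        where
        cases : Dec (j ≡ ℓ) → Empty
        cases (yes j≡ℓ) = contradiction (trans (sym gain-ℓ) (trans (cong (gain H) (sym j≡ℓ)) gain≡ε)) (λ ())
        cases (no j≢ℓ)  = proj₂ gg (kept j) (trans (sym (src-kept j≢ℓ)) (trans (cong old src≡tgt) (tgt-kept j≢ℓ)))
                            (trans (sym (gain-kept j≢ℓ)) gain≡ε)

    H-count : k + 1 ≡ 2 * m
    H-count = ℕ.suc-injective (ℕ.suc-injective (trans (proj₂ (proj₁ qt)) (cong suc (ℕ.+-suc m (m + 0)))))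

    liftV : Bool → Subset m → Subset (suc m)
    liftV withV₀ S = insertAt S v₀ withV₀

    liftE : Bool → Subset k → Subset (suc (suc k))
    liftE withDropped S = insertAt (insertAt S q withDropped) e0b withDropped

    ∣liftV∣ : ∀ withV₀ S → ∣ liftV withV₀ S ∣ ≡ ind withV₀ + ∣ S ∣
    ∣liftV∣ withV₀ S = ∣insertAt∣≡ind+∣p∣ S v₀ withV₀

    ∣liftE∣ : ∀ withDropped S → ∣ liftE withDropped S ∣ ≡ ind withDropped + (ind withDropped + ∣ S ∣)
    ∣liftE∣ withDropped S = trans (∣insertAt∣≡ind+∣p∣ (insertAt S q withDropped) e0b withDropped)
                                  (cong (ind withDropped +_) (∣insertAt∣≡ind+∣p∣ S q withDropped))

    old∈liftV : ∀ {withV₀ S x} → x ∈ S → old x ∈ liftV withV₀ S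
    old∈liftV {withV₀} {S} = punchIn∈insertAt⁺ S v₀ withV₀

    old∈liftV⁻ : ∀ {withV₀ S x} → old x ∈ liftV withV₀ S → x ∈ S
    old∈liftV⁻ {withV₀} {S} = punchIn∈insertAt⁻ S v₀ withV₀

    kept∈liftE : ∀ {withDropped S j} → j ∈ S → kept j ∈ liftE withDropped S
    kept∈liftE {withDropped} {S} j∈ = punchIn∈insertAt⁺ _ e0b withDropped (punchIn∈insertAt⁺ S q withDropped j∈)

    kept∈liftE⁻ : ∀ {withDropped S j} → kept j ∈ liftE withDropped S → j ∈ S
    kept∈liftE⁻ {withDropped} {S} j∈ = punchIn∈insertAt⁻ S q withDropped (punchIn∈insertAt⁻ _ e0b withDropped j∈)

    ∈liftE-false⁻ : ∀ {S e} → e ∈ liftE false S → Σ (Fin k) λ j → kept j ≡ e × j ∈ S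
    ∈liftE-false⁻ {S} {e} e∈ with edgeView e
    ... | dropped-b   = contradiction e∈ (i∉insertAt-outside _ e0b)
    ... | dropped-c   = contradiction
                          (punchIn∈insertAt⁻ _ e0b false
                            (subst (_∈ liftE false S) (sym (punchIn-punchOut e0b≢e0c)) e∈))
                          (i∉insertAt-outside S q)
    ... | kept-edge j = j , refl , kept∈liftE⁻ e∈

    ≢ℓ : ∀ {ES j} → ℓ ∉ ES → j ∈ ES → j ≢ ℓ
    ≢ℓ ℓ∉ j∈ refl = ℓ∉ j∈

    lift-subgraph : ∀ {VS ES} → IsSubgraph H VS ES → ℓ ∉ ES → IsSubgraph G (liftV false VS) (liftE false ES)
    lift-subgraph sub ℓ∉ e e∈ with ∈liftE-false⁻ e∈
    ... | j , refl , j∈ = subst (_∈ _) (src-kept (≢ℓ ℓ∉ j∈)) (old∈liftV (proj₁ (sub j j∈)))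
                        , subst (_∈ _) (tgt-kept (≢ℓ ℓ∉ j∈)) (old∈liftV (proj₂ (sub j j∈)))

    liftV-⊆ : ∀ {S S′} → S ⊆ S′ → liftV false S ⊆ liftV false S′
    liftV-⊆ {S} S⊆S′ {x} x∈ with punchInView v₀ x
    ... | pivot     = contradiction x∈ (i∉insertAt-outside S v₀)
    ... | punched y = old∈liftV (S⊆S′ (old∈liftV⁻ x∈))

    liftE-⊆ : ∀ {S S′} → S ⊆ S′ → liftE false S ⊆ liftE false S′
    liftE-⊆ S⊆S′ e∈ with ∈liftE-false⁻ e∈
    ... | j , refl , j∈ = kept∈liftE (S⊆S′ j∈)

    kept-walk : ∀ {ES} → ℓ ∉ ES → ∀ {x y} (w : Walk G (liftE false ES) x y) → ∀ {x′ y′} → old x′ ≡ x → old y′ ≡ y →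
                Σ (Walk H ES x′ y′) λ w′ → netGain w′ ≡ netGain w
    kept-walk ℓ∉ [] x≡ y≡ with old-injective (trans x≡ (sym y≡))
    ... | refl = [] , refl
    kept-walk ℓ∉ (fwd e e∈ w) x≡ y≡ with ∈liftE-false⁻ e∈
    ... | j , refl , j∈ with old-injective (trans x≡ (sym (src-kept (≢ℓ ℓ∉ j∈))))
                           | kept-walk ℓ∉ w (tgt-kept (≢ℓ ℓ∉ j∈)) y≡
    ...   | refl | w′ , w′≡ = fwd j j∈ w′ , cong₂ _·_ (gain-kept (≢ℓ ℓ∉ j∈)) w′≡
    kept-walk ℓ∉ (bwd e e∈ w) x≡ y≡ with ∈liftE-false⁻ e∈
    ... | j , refl , j∈ with old-injective (trans x≡ (sym (tgt-kept (≢ℓ ℓ∉ j∈))))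
                           | kept-walk ℓ∉ w (src-kept (≢ℓ ℓ∉ j∈)) y≡
    ...   | refl | w′ , w′≡ = bwd j j∈ w′ , cong₂ _·_ (cong _⁻¹ (gain-kept (≢ℓ ℓ∉ j∈))) w′≡

    kept-gainSpace : ∀ {ES} → ℓ ∉ ES → ∀ {u z} → GainSpace G (liftE false ES) (old u) z → GainSpace H ES u z
    kept-gainSpace ℓ∉ (gen w) with kept-walk ℓ∉ w refl refl
    ... | w′ , w′≡ = subst (GainSpace H _ _) w′≡ (gen w′)
    kept-gainSpace ℓ∉ unit      = unit
    kept-gainSpace ℓ∉ (mul x y) = mul (kept-gainSpace ℓ∉ x) (kept-gainSpace ℓ∉ y)
    kept-gainSpace ℓ∉ (inv x)   = inv (kept-gainSpace ℓ∉ x)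

    H-periodic-sparse : ∀ VS ES → IsSubgraph H VS ES → IsPurelyPeriodic H VS ES → SparseOn 2 2 H VS ES
    H-periodic-sparse VS ES sub periodic with ℓ ∈? ES
    ... | yes ℓ∈ = contradiction (subst IsTranslation gain-ℓ
                     (periodic _ (proj₁ (sub ℓ ℓ∈)) _ (GraphBasics.loop∈GainSpace H ℓ ℓ∈ (trans src-ℓ (sym tgt-ℓ)))))
                     (λ ())
    ... | no ℓ∉ = λ VS′ ES′ sub′ VS′⊆VS ES′⊆ES 1≤∣ES′∣ →
      subst₂ (λ e w → e + 2 ≤ 2 * w) (∣liftE∣ false ES′) (∣liftV∣ false VS′)
        (proj₂ qt (liftV false VS) (liftE false ES) (lift-subgraph sub ℓ∉) lifted-periodic
          (liftV false VS′) (liftE false ES′) (lift-subgraph sub′ (λ ℓ∈ → ℓ∉ (ES′⊆ES ℓ∈)))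
          (liftV-⊆ VS′⊆VS) (liftE-⊆ ES′⊆ES) (subst (1 ≤_) (sym (∣liftE∣ false ES′)) 1≤∣ES′∣))
      where
      lifted-periodic : IsPurelyPeriodic G (liftV false VS) (liftE false ES)
      lifted-periodic u u∈ z z∈ with punchInView v₀ u
      ... | pivot     = contradiction u∈ (i∉insertAt-outside VS v₀)
      ... | punched y = periodic y (old∈liftV⁻ u∈) z (kept-gainSpace ℓ∉ z∈)

    module ThroughLoop {VS ES} (sub : IsSubgraph H VS ES) (ℓ∈ : ℓ ∈ ES) where

      a′∈ : a′ ∈ VS
      a′∈ = subst (_∈ VS) src-ℓ (proj₁ (sub ℓ ℓ∈))

      W : List (Fin (suc m)) → Subset (suc m)
      W X = addAll (liftV true VS) X

      old∈W : ∀ X {y} → y ∈ VS → old y ∈ W X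
      old∈W X y∈ = ∈-addAll⁺ˡ X (old∈liftV y∈)

      v₀∈W : ∀ X → v₀ ∈ W X
      v₀∈W X = ∈-addAll⁺ˡ X (i∈insertAt-inside VS v₀)

      va∈W : ∀ X → va ∈ W X
      va∈W X = subst (_∈ W X) old-a′ (old∈W X a′∈)

      liftE-true-ends : ∀ X → vb ∈ W X → vc ∈ W X → ∀ e → e ∈ liftE true ES → src G e ∈ W X × tgt G e ∈ W X
      liftE-true-ends X vb∈ vc∈ e e∈ with edgeView e
      ... | dropped-b   = Joins-ends∈ J0b (v₀∈W X) vb∈
      ... | dropped-c   = Joins-ends∈ J0c (v₀∈W X) vc∈
      ... | kept-edge j with j ≟ ℓ
      ...   | yes refl = subst (λ e → src G e ∈ W X × tgt G e ∈ W X) (sym kept-ℓ) (Joins-ends∈ J0a (v₀∈W X) (va∈W X))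
      ...   | no j≢ℓ   = subst (_∈ W X) (src-kept j≢ℓ) (old∈W X (proj₁ (sub j (kept∈liftE⁻ e∈))))
                       , subst (_∈ W X) (tgt-kept j≢ℓ) (old∈W X (proj₂ (sub j (kept∈liftE⁻ e∈))))

      -- Adding v₀ with its three edges, and vertices X with at least 2|X| edges Y, keeps |E| ≥ 2|V|.
      ¬dense-extension : 2 * ∣ VS ∣ ≤ ∣ ES ∣ → ∀ X Y → Unique X → All (_∉ liftV true VS) X →
        Unique Y → All (_∉ liftE true ES) Y → 2 * length X ≤ length Y → vb ∈ W X → vc ∈ W X →
        (∀ {e} → e ∈ₗ Y → src G e ∈ W X × tgt G e ∈ W X) → Empty
      ¬dense-extension dense X Y X-unique X∉ Y-unique Y∉ few vb∈ vc∈ Y-ends =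
        extension-¬sparse (length X + 1) (length Y + 2) 0 (subst (2 * ∣ VS ∣ ≤_) (sym (ℕ.+-identityʳ _)) dense)
          (subst (_≤ length Y + 2) (sym (trans (ℕ.+-identityʳ _) (ℕ.*-distribˡ-+ 2 (length X) 1)))
            (ℕ.+-monoˡ-≤ 2 few))
          (subst₂ (λ e w → e + 1 ≤ 2 * w) ∣F∣ ∣W∣ (sparse-count sparse F-subgraph 1≤∣F∣))
        where
        F = addAll (liftE true ES) Y
        ∣W∣ : ∣ W X ∣ ≡ (length X + 1) + ∣ VS ∣
        ∣W∣ = trans (∣addAll∣≡length+∣p∣ (liftV true VS) X X-unique X∉)
                    (trans (cong (length X +_) (∣liftV∣ true VS)) (sym (ℕ.+-assoc (length X) 1 _)))
        ∣F∣ : ∣ F ∣ ≡ (length Y + 2) + ∣ ES ∣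
        ∣F∣ = trans (∣addAll∣≡length+∣p∣ (liftE true ES) Y Y-unique Y∉)
                    (trans (cong (length Y +_) (∣liftE∣ true ES)) (sym (ℕ.+-assoc (length Y) 2 _)))
        1≤∣F∣ : 1 ≤ ∣ F ∣
        1≤∣F∣ = subst (1 ≤_) (sym ∣F∣) (ℕ.≤-trans (s≤s z≤n) (ℕ.≤-trans (ℕ.m≤n+m 2 (length Y)) (ℕ.m≤m+n _ _)))
        F-subgraph : IsSubgraph G (W X) F
        F-subgraph e e∈ with ∈-addAll⁻ (liftE true ES) Y e∈
        ... | inj₁ e∈E = liftE-true-ends X vb∈ vc∈ e e∈E
        ... | inj₂ e∈Y = Y-ends e∈Y

      outside∉ : ∀ {e i j} → Joins G e (v i) (v j) → zero ≢ i → zero ≢ j →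
                 ∀ {x′} → old x′ ≡ v j → x′ ∉ VS → e ∉ liftE true ES
      outside∉ J 0≢i 0≢j x≡ x′∉ e∈ with kept-index J 0≢i 0≢j
      ... | j′ , refl , j′≢ℓ with Joins-incidentʳ J
      ...   | inj₁ src≡ = x′∉ (subst (_∈ VS) (old-injective (trans (src-kept j′≢ℓ) (trans src≡ (sym x≡))))
                                    (proj₁ (sub j′ (kept∈liftE⁻ e∈))))
      ...   | inj₂ tgt≡ = x′∉ (subst (_∈ VS) (old-injective (trans (tgt-kept j′≢ℓ) (trans tgt≡ (sym x≡))))
                                    (proj₂ (sub j′ (kept∈liftE⁻ e∈))))

      one-outside : 2 * ∣ VS ∣ ≤ ∣ ES ∣ → ∀ {x y} (a≢x : a ≢ x) (y≢x : y ≢ x) → a ≢ y → zero ≢ x → zero ≢ y →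
        ∀ {x′ y′} → old x′ ≡ v x → old y′ ≡ v y → x′ ∉ VS → y′ ∈ VS →
        (v x ∈ W (v x ∷ []) → v y ∈ W (v x ∷ []) → vb ∈ W (v x ∷ []) × vc ∈ W (v x ∷ [])) → Empty
      one-outside dense {x} {y} a≢x y≢x a≢y 0≢x 0≢y x≡ y≡ x′∉ y′∈ b,c∈ =
        ¬dense-extension dense (v x ∷ []) (edge a x a≢x ∷ edge y x y≢x ∷ [])
          ([] ∷ []) (vx∉ ∷ [])
          ((joins-≢ (edge-joins a x a≢x) (edge-joins y x y≢x) a≢y a≢x ∷ []) ∷ [] ∷ [])
          (outside∉ (edge-joins a x a≢x) 0≢a 0≢x x≡ x′∉ ∷ outside∉ (edge-joins y x y≢x) 0≢y 0≢x x≡ x′∉ ∷ [])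
          (s≤s (s≤s z≤n)) (proj₁ (b,c∈ vx∈ vy∈)) (proj₂ (b,c∈ vx∈ vy∈)) ends
        where
        vx∈ : v x ∈ W (v x ∷ [])
        vx∈ = ∈-addAll⁺ʳ (liftV true VS) {v x ∷ []} (here refl)
        vy∈ : v y ∈ W (v x ∷ [])
        vy∈ = subst (_∈ W (v x ∷ [])) y≡ (old∈W (v x ∷ []) y′∈)
        vx∉ : v x ∉ liftV true VS
        vx∉ vx∈′ = x′∉ (old∈liftV⁻ (subst (_∈ liftV true VS) (sym x≡) vx∈′))
        ends : ∀ {e} → e ∈ₗ edge a x a≢x ∷ edge y x y≢x ∷ [] → src G e ∈ W (v x ∷ []) × tgt G e ∈ W (v x ∷ [])
        ends (here refl)         = Joins-ends∈ (edge-joins a x a≢x) (va∈W (v x ∷ [])) vx∈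
        ends (there (here refl)) = Joins-ends∈ (edge-joins y x y≢x) vy∈ vx∈

      blocker : b′ ∉ VS → c′ ∉ VS → 2 * ∣ VS ∣ ≤ ∣ ES ∣ → Obstruction.Blocker G sparse v k4 a
      blocker b′∉ c′∉ dense = record
        { vertices = liftV false VS
        ; edges    = liftE false (ES - ℓ)
        ; subgraph = lift-subgraph (λ e e∈ → sub e (proj₁ (x∈p-y⁻ e∈))) (λ ℓ∈′ → proj₂ (x∈p-y⁻ ℓ∈′) refl)
        ; meets    = subst (_∈ liftV false VS) old-a′ (old∈liftV a′∈)
        ; avoids   = avoids
        ; dense    = subst₂ (λ w e → 2 * w ≤ e) (sym (∣liftV∣ false VS))
                       (trans (∣p∣≡1+∣p-x∣ ES ℓ∈) (trans (cong suc (sym (∣liftE∣ false (ES - ℓ)))) (ℕ.+-comm 1 _)))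
                       dense
        }
        where
        avoids : ∀ j → j ≢ a → v j ∉ liftV false VS
        avoids j j≢a with distinct-exhaust 0≢a 0≢b 0≢c a≢b a≢c b≢c j
        ... | inj₁ refl                 = i∉insertAt-outside VS v₀
        ... | inj₂ (inj₁ refl)          = contradiction refl j≢a
        ... | inj₂ (inj₂ (inj₁ refl))   = λ vb∈ → b′∉ (old∈liftV⁻ (subst (_∈ liftV false VS) (sym old-b′) vb∈))
        ... | inj₂ (inj₂ (inj₂ refl))   = λ vc∈ → c′∉ (old∈liftV⁻ (subst (_∈ liftV false VS) (sym old-c′) vc∈))

      loop-subgraph-¬dense : ¬ (2 * ∣ VS ∣ ≤ ∣ ES ∣)
      loop-subgraph-¬dense dense with b′ ∈? VS | c′ ∈? VS
      ... | yes b′∈ | yes c′∈ = ¬dense-extension dense [] [] [] [] [] [] z≤n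
                                  (subst (_∈ liftV true VS) old-b′ (old∈liftV b′∈))
                                  (subst (_∈ liftV true VS) old-c′ (old∈liftV c′∈)) (λ ())
      ... | yes b′∈ | no c′∉  = one-outside dense a≢c b≢c a≢b 0≢c 0≢b old-c′ old-b′ c′∉ b′∈ (λ c∈ b∈ → b∈ , c∈)
      ... | no b′∉  | yes c′∈ = one-outside dense a≢b (≢-sym b≢c) a≢c 0≢b 0≢c old-b′ old-c′ b′∉ c′∈ (λ b∈ c∈ → b∈ , c∈)
      ... | no b′∉  | no c′∉  = unblocked (blocker b′∉ c′∉ dense)

    H-sparse : Sparse 2 1 H
    H-sparse VS ES sub _ _ 1≤∣ES∣ with ℓ ∈? ES
    ... | yes ℓ∈ = subst (_≤ 2 * ∣ VS ∣) (ℕ.+-comm 1 ∣ ES ∣) (ℕ.≰⇒> (ThroughLoop.loop-subgraph-¬dense sub ℓ∈))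
    ... | no ℓ∉  = subst₂ (λ e w → e + 1 ≤ 2 * w) (∣liftE∣ false ES) (∣liftV∣ false VS)
                     (sparse-count sparse (lift-subgraph sub ℓ∉) (subst (1 ≤_) (sym (∣liftE∣ false ES)) 1≤∣ES∣))

    H-qtight : QTight H
    H-qtight = (H-sparse , H-count) , H-periodic-sparse

    xa xb xc g₁₂ g₁₃ : Γ
    xa = orientedGain J0a
    xb = orientedGain J0b
    xc = orientedGain J0c
    g₁₂ = orientedGain Jab
    g₁₃ = orientedGain Jac

    -- Switching G at v₀ by δ turns the gain of e0a, read from v₀, into the loop gain γ.
    δ g₀₂ g₀₃ : Γ
    δ = γ · (xa ⁻¹)
    g₀₂ = δ · xb
    g₀₃ = δ · xc

    δ·xa≡γ : δ · xa ≡ γ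
    δ·xa≡γ = trans (·-assoc γ (xa ⁻¹) xa) (trans (cong (γ ·_) (·-inverseˡ xa)) (·-identityʳ γ))

    4-cycle-gain : (g₀₂ ⁻¹) · g₀₃ ≡ (g₁₂ ⁻¹) · g₁₃
    4-cycle-gain = begin
      ((δ · xb) ⁻¹) · (δ · xc)        ≡⟨ cong (_· (δ · xc)) (⁻¹-anti-homo-∙ δ xb) ⟩
      ((xb ⁻¹) · (δ ⁻¹)) · (δ · xc)   ≡⟨ ·-cancel-middle (xb ⁻¹) δ xc ⟩
      (xb ⁻¹) · xc                    ≡⟨ inverseˡ-unique _ _ cycle ⟩
      ((g₁₃ ⁻¹) · g₁₂) ⁻¹             ≡⟨ ⁻¹-anti-homo-∙ (g₁₃ ⁻¹) g₁₂ ⟩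
      (g₁₂ ⁻¹) · ((g₁₃ ⁻¹) ⁻¹)        ≡⟨ cong ((g₁₂ ⁻¹) ·_) (⁻¹-involutive g₁₃) ⟩
      (g₁₂ ⁻¹) · g₁₃                  ∎
      where
      open ≡-Reasoning
      cycle : ((xb ⁻¹) · xc) · ((g₁₃ ⁻¹) · g₁₂) ≡ ε
      cycle = begin
        ((xb ⁻¹) · xc) · ((g₁₃ ⁻¹) · g₁₂)
          ≡⟨ ·-assoc (xb ⁻¹) xc _ ⟩
        (xb ⁻¹) · (xc · ((g₁₃ ⁻¹) · g₁₂))
          ≡⟨ cong₂ (λ x y → x · (xc · (y · g₁₂))) (sym (orientedGain-sym J0b)) (sym (orientedGain-sym Jac)) ⟩
        orientedGain (Joins-sym J0b) · (xc · (orientedGain (Joins-sym Jac) · g₁₂))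
          ≡⟨ cycle-balanced (Joins-sym J0b) J0c (Joins-sym Jac) Jab ⟩
        ε ∎

    ch : Fin k → Maybe Bool
    ch j = atLoop j (just true) nothing

    valid-choice : ValidChoice H a′ {1} (λ e → Maybe.map (λ b → b , zero) (ch e))
    valid-choice e _ _ eq with e ≟ ℓ | eq
    ... | yes refl | refl = refl
    ... | no _     | ()

    edgeFrom : ∀ {j e x y x′ y′} → j ≢ ℓ → kept j ≡ e → old x′ ≡ x → old y′ ≡ y → (J : Joins G e x y) →
               EdgeFrom H j x′ y′ (orientedGain J)
    edgeFrom j≢ℓ refl x≡ y≡ (inj₁ (src≡ , tgt≡)) =
      inj₁ ( old-injective (trans (src-kept j≢ℓ) (trans src≡ (sym x≡)))
           , old-injective (trans (tgt-kept j≢ℓ) (trans tgt≡ (sym y≡)))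
           , gain-kept j≢ℓ )
    edgeFrom j≢ℓ refl x≡ y≡ (inj₂ (src≡ , tgt≡)) =
      inj₂ ( old-injective (trans (src-kept j≢ℓ) (trans src≡ (sym y≡)))
           , old-injective (trans (tgt-kept j≢ℓ) (trans tgt≡ (sym x≡)))
           , trans (gain-kept j≢ℓ) (sym (⁻¹-involutive _)) )

    G′ C : GainGraph
    G′ = switch G v₀ δ
    C  = vertexToC4 H b′ c′ g₀₂ g₀₃ ch

    π : Fin (m + 1) → Fin (suc m)
    π = punchInOrPivot v₀

    τ : Fin (k + 2) → Fin (suc (suc k))
    τ = punchIn²OrPivots e0b q

    Matches : Fin (k + 2) → Set
    Matches e =
      (src G′ (τ e) ≡ π (src C e) × tgt G′ (τ e) ≡ π (tgt C e) × gain G′ (τ e) ≡ gain C e)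
      ⊎ (src G′ (τ e) ≡ π (tgt C e) × tgt G′ (τ e) ≡ π (src C e) × gain G′ (τ e) ≡ gain C e ⁻¹)

    matches-at-v₀ : ∀ {e e′ w w′ x} (J : Joins G e′ v₀ w) → old w′ ≡ w → τ e ≡ e′ →
      src C e ≡ m ↑ʳ zero × tgt C e ≡ w′ ↑ˡ 1 × gain C e ≡ x → δ · orientedGain J ≡ x → Matches e
    matches-at-v₀ {e} {e′} {w} {w′} (inj₁ (src≡ , tgt≡)) old≡ τ≡ (srcC , tgtC , gainC) δx≡ = inj₁
      ( trans (cong s τ≡) (trans src≡ (sym (trans (cong π srcC) (punchInOrPivot-↑ʳ v₀))))
      , trans (cong t τ≡) (trans tgt≡ (sym (trans (cong π tgtC) (trans (punchInOrPivot-↑ˡ v₀ w′) old≡))))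
      , trans (cong (gain G′) τ≡)
          (trans (switchGain-out v₀ δ (g e′) src≡ (λ t≡v₀ → old≢v₀ w′ (trans old≡ (trans (sym tgt≡) t≡v₀))))
                 (trans δx≡ (sym gainC))) )
    matches-at-v₀ {e} {e′} {w} {w′} (inj₂ (src≡ , tgt≡)) old≡ τ≡ (srcC , tgtC , gainC) δx≡ = inj₂
      ( trans (cong s τ≡) (trans src≡ (sym (trans (cong π tgtC) (trans (punchInOrPivot-↑ˡ v₀ w′) old≡))))
      , trans (cong t τ≡) (trans tgt≡ (sym (trans (cong π srcC) (punchInOrPivot-↑ʳ v₀))))
      , trans (cong (gain G′) τ≡)
          (trans (switchGain-in v₀ δ (g e′) (λ s≡v₀ → old≢v₀ w′ (trans old≡ (trans (sym src≡) s≡v₀))) tgt≡)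
                 (trans reversed (cong _⁻¹ (trans δx≡ (sym gainC))))) )
      where
      reversed : g e′ · (δ ⁻¹) ≡ (δ · (g e′ ⁻¹)) ⁻¹
      reversed = sym (trans (⁻¹-anti-homo-∙ δ (g e′ ⁻¹)) (cong (_· (δ ⁻¹)) (⁻¹-involutive (g e′))))

    matches-kept : ∀ j → j ≢ ℓ → Matches (j ↑ˡ 2)
    matches-kept j j≢ℓ = inj₁
      ( trans (cong s (punchIn²OrPivots-↑ˡ e0b q j))
          (sym (trans (cong π (proj₁ C-edge)) (trans (punchInOrPivot-↑ˡ v₀ _) (src-kept j≢ℓ))))
      , trans (cong t (punchIn²OrPivots-↑ˡ e0b q j))
          (sym (trans (cong π (proj₁ (proj₂ C-edge))) (trans (punchInOrPivot-↑ˡ v₀ _) (tgt-kept j≢ℓ))))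
      , trans (cong (gain G′) (punchIn²OrPivots-↑ˡ e0b q j))
          (trans (switchGain-away v₀ δ (g (kept j)) (kept-avoids-v₀ j≢ℓ ∘ inj₁) (kept-avoids-v₀ j≢ℓ ∘ inj₂))
                 (sym (trans (proj₂ (proj₂ C-edge)) (gain-kept j≢ℓ)))) )
      where
      C-edge = VertexToC4.unchanged H b′ c′ g₀₂ g₀₃ ch j (atLoop-≢ j≢ℓ)

    matches-loop : Matches (ℓ ↑ˡ 2)
    matches-loop with VertexToC4.source-moved H b′ c′ g₀₂ g₀₃ ch ℓ atLoop-ℓ
    ... | srcC , tgtC , gainC = matches-at-v₀ J0a old-a′ (trans (punchIn²OrPivots-↑ˡ e0b q ℓ) kept-ℓ)
            (srcC , trans tgtC (cong (_↑ˡ 1) tgt-ℓ) , trans gainC gain-ℓ) δ·xa≡γ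

    matches : ∀ e → Matches e
    matches e with splitView k 2 e
    ... | left j with j ≟ ℓ
    ...   | yes refl = matches-loop
    ...   | no j≢ℓ   = matches-kept j j≢ℓ
    matches e | right zero =
      matches-at-v₀ J0b old-b′ (punchIn²OrPivots-↑ʳ₀ e0b q) (VertexToC4.new₂ H b′ c′ g₀₂ g₀₃ ch) refl
    matches e | right (suc zero) =
      matches-at-v₀ J0c old-c′ (trans (punchIn²OrPivots-↑ʳ₁ e0b q) (punchIn-punchOut e0b≢e0c))
        (VertexToC4.new₃ H b′ c′ g₀₂ g₀₃ ch) refl

    recovers-G : Equivalent C G
    recovers-G = inj₁ (inj₂ (punchInOrPivot-↔ v₀ , punchIn²OrPivots-↔ e0b q , matches))
               ◅ inj₂ (inj₁ (v₀ , δ , refl))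
               ◅ done

    4-cycle-to-vertex : C4ToVertex G H
    4-cycle-to-vertex with kept-index Jab 0≢a 0≢b | kept-index Jac 0≢a 0≢c
    ... | i₁₂ , kept≡eab , i₁₂≢ℓ | i₁₃ , kept≡eac , i₁₃≢ℓ =
      a′ , b′ , c′ , i₁₂ , i₁₃ , g₁₂ , g₁₃ , g₀₂ , g₀₃ , ch ,
      edgeFrom i₁₂≢ℓ kept≡eab old-a′ old-b′ Jab , edgeFrom i₁₃≢ℓ kept≡eac old-a′ old-c′ Jac ,
      (λ b′≡c′ → v-≢ b≢c (trans (sym old-b′) (trans (cong old b′≡c′) old-c′))) ,
      4-cycle-gain , valid-choice , atLoop-≢ i₁₂≢ℓ , atLoop-≢ i₁₃≢ℓ , recovers-G

    reduced : Σ GainGraph λ H → IsGainGraph H × QTight H × nV H < nV G × (K4ToVertex G H ⊎ C4ToVertex G H)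
    reduced = H , H-isGainGraph , H-qtight , ℕ.≤-refl , inj₂ 4-cycle-to-vertex

proposition7p18 : (G : GainGraph) → IsGainGraph G → QTight G →
    (v : Fin 4 → Fin (nV G)) → degree G (v zero) ≡ 3 → InducesBalancedK4 G v →
    Σ GainGraph λ H → IsGainGraph H × QTight H × nV H < nV G ×
      (K4ToVertex G H ⊎ C4ToVertex G H)
proposition7p18 record { nV = zero } _ _ v _ _ with v zero
... | ()
proposition7p18 G@record { nV = suc _ ; nE = zero } _ _ v deg _ =
  contradiction (subst (λ d → d ≤ 0) deg (GraphBasics.degree≤nE*2 G (v zero))) λ ()
proposition7p18 G@record { nV = suc _ ; nE = suc zero } _ _ v deg _ =
  contradiction (subst (λ d → d ≤ 2) deg (GraphBasics.degree≤nE*2 G (v zero))) λ { (s≤s (s≤s ())) }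
proposition7p18 G@record { nV = suc m ; nE = suc (suc k) ; src = s ; tgt = t ; gain = g } gg qt v deg k4
  with Obstruction.blocker? G (proj₁ (proj₁ qt)) v k4 (suc zero)
... | no ¬blocked₁ = Reduction.reduced m k s t g gg qt v deg k4 (suc zero) (suc (suc zero)) (suc (suc (suc zero)))
                       (λ ()) (λ ()) (λ ()) (λ ()) (λ ()) (λ ()) ¬blocked₁
... | yes blocked₁ = Reduction.reduced m k s t g gg qt v deg k4 (suc (suc zero)) (suc zero) (suc (suc (suc zero)))
                       (λ ()) (λ ()) (λ ()) (λ ()) (λ ()) (λ ()) (Obstruction.blockers-exclusive G _ v k4 blocked₁)
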